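{- Let $k$ be a positive integer, $a=12k+8$, $b=a+2$, $c=b+\frac b2$, and $S=\{a,b,c\}=\{12k+8,12k+10,18k+15\}$, $G=\langle S\rangle$. Let $A_{0,k}=\{0\}$, $B_{0,k}=\emptyset$, and for $i\in[1,6k+4]$ let $A_{i,k}=\{ia+2h: 0\le h\le i\}$ and $B_{i,k}=\{ia+\frac a2+3+2h: 0\le h\le i-1\}$. Let $H_{15,k}=\bigcup_{i=0}^{6k+4}(A_{i,k}\cup B_{i,k})\cup[(6k+4)a+\frac a2+3,\infty[$. Then: (1) $x\in G$ if and only if $x=(q+3v+\epsilon)a+\epsilon\cdot\frac a2+6v+3\epsilon+2r$ for some $q,r,v\in\mathbb{N}$, $\epsilon\in\{0,1\}$ with $0\le r\le q$; (2) $G=H_{15,k}$; (3) $H_{15,k}$ is a $3$-permutation numerical semigroup.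
   Context: $[u,v]=\{x\in\mathbb{N}: u\le x\le v\}$ and $[u,\infty[\,=\{x\in\mathbb{N}:x\ge u\}$. A numerical semigroup is a submonoid $G$ of $(\mathbb{N},+,0)$ with $\mathbb{N}\setminus G$ finite; $\langle S\rangle$ is the submonoid generated by $S$. Write the elements of $G$ as $0=g_0<g_1<g_2<\cdots$. For $n\ge 1$, $G$ is an $n$-permutation numerical semigroup if $G=\langle g_1,\dots,g_n\rangle$ and for every integer $k\ge 0$ the tuple $(g_{kn+1}\bmod n,\dots,g_{kn+n}\bmod n)$ contains exactly one representative of each residue class of $\mathbb{Z}/n\mathbb{Z}$. -}

module Defs where

open import Data.Nat using (ℕ; zero; suc; _+_; _*_; _≤_; _<_; NonZero)
open import Data.Nat.DivMod using (_/_; _%_)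
open import Data.Fin using (Fin; toℕ)
open import Data.List using (List; []; _∷_; map; upTo)
open import Data.Product using (Σ; ∃; ∃-syntax; _×_; _,_)
open import Data.Sum using (_⊎_)
open import Data.Empty using (⊥)
open import Data.Unit using (⊤)
open import Relation.Binary.PropositionalEquality using (_≡_)
open import Function.Bundles using (_⇔_)

Pred : Set₁
Pred = ℕ → Set

Generated : List ℕ → Pred
Generated []       x = x ≡ 0
Generated (g ∷ gs) x = ∃[ m ] ∃[ y ] (Generated gs y × x ≡ m * g + y)

IsNumericalSemigroup : Pred → Set
IsNumericalSemigroup G =
  G 0 × (∀ x y → G x → G y → G (x + y)) × (∃[ N ] (∀ x → N ≤ x → G x))

IsEnumeration : Pred → (ℕ → ℕ) → Set
IsEnumeration G g =
  (g 0 ≡ 0) × (∀ i → G (g i)) × (∀ i → g i < g (suc i))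
  × (∀ x → G x → ∃[ i ] (g i ≡ x))

ExactlyOne : {A : Set} → (A → Set) → Set
ExactlyOne {A} P = Σ A λ a → P a × (∀ b → P b → b ≡ a)

IsPermutationNS : (n : ℕ) → .{{_ : NonZero n}} → Pred → Set
IsPermutationNS n G =
  IsNumericalSemigroup G ×
  ∃[ g ] (IsEnumeration G g
    × (∀ x → G x ⇔ Generated (map (λ i → g (suc i)) (upTo n)) x)
    × (∀ k → (ρ : Fin n) →
         ExactlyOne {Fin n} (λ j → g (k * n + toℕ j + 1) % n ≡ toℕ ρ)))

aₖ bₖ cₖ : ℕ → ℕ
aₖ k = 12 * k + 8
bₖ k = aₖ k + 2
cₖ k = bₖ k + bₖ k / 2

Gₖ : ℕ → Pred
Gₖ k = Generated (aₖ k ∷ bₖ k ∷ cₖ k ∷ [])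

A : ℕ → ℕ → Pred
A k zero    x = x ≡ 0
A k (suc j) x = let i = suc j in ∃[ h ] (h ≤ i × x ≡ i * aₖ k + 2 * h)

B : ℕ → ℕ → Pred
B k zero    x = ⊥
B k (suc j) x = let i = suc j in
  ∃[ h ] (h ≤ i Data.Nat.∸ 1 × x ≡ i * aₖ k + aₖ k / 2 + 3 + 2 * h)

H15 : ℕ → Pred
H15 k x =
  (∃[ i ] (i ≤ 6 * k + 4 × (A k i x ⊎ B k i x)))
  ⊎ ((6 * k + 4) * aₖ k + aₖ k / 2 + 3 ≤ x)

-- Write a = 12k + 8.  Since 2c = 3a + 6, an element m a + n b + (2v + ε) c of G
-- equals (q + 3v + ε) a + ε a/2 + 6v + 3ε + 2r with q = m + n and r = n, and
-- conversely; for ε = 0 these are the sets A_i and for ε = 1 the sets B_i (with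
-- i = q + 3v + ε), and beyond (6k + 4) a + a/2 + 3 every integer has this form.
--
-- For the permutation property, cut ℕ into the windows [i a, (i + 1) a).  Below the
-- conductor window i holds the even offsets 2h ≤ 2i (A_i), the odd offsets from
-- a/2 + 3 on (B_i) and, for i ≥ 3k + 3, the odd offsets of B_(i-1) spilling over.
-- So H₁₅ is a succession of runs of consecutive integers or of integers of one
-- parity, along which residues mod 3 advance by 1 or by 2, so that any three
-- consecutive elements of a run are pairwise incongruent.  Scanning H₁₅ in
-- increasing order while recording the residues of the current incomplete block
-- of three, it remains to check at each junction between runs that the next
-- residue is new to its block; in each window this depends only on the index of
-- the window mod 3, and is checked by computation.

module Submission where

open import Defs
open import Data.Nat using (ℕ; _+_; _*_; _≤_)
open import Data.Nat.DivMod using (_/_)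
open import Data.Product using (_×_; ∃-syntax)
open import Relation.Binary.PropositionalEquality using (_≡_)
open import Function.Bundles using (_⇔_)
open import Data.Nat
open import Data.Nat.Properties
open import Data.Nat.DivMod
open import Data.Nat.Tactic.RingSolver using (solve-∀)
open import Data.Product using (_,_; proj₁; proj₂)
open import Data.Sum using (_⊎_; inj₁; inj₂; [_,_]′)
open import Data.Empty using (⊥; ⊥-elim)
open import Data.Unit using (⊤; tt)
open import Data.List using ([]; _∷_; map; upTo)
open import Data.Fin using (Fin; toℕ)
open import Data.Fin.Patterns using (0F; 1F; 2F)
open import Relation.Binary.PropositionalEquality
open import Relation.Nullary using (¬_; Dec; yes; no)
open import Relation.Nullary.Decidable using (_⊎-dec_; map′)
open import Relation.Binary.Definitions using (tri<; tri≈; tri>)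
open import Function.Bundles using (mk⇔; Equivalence)

≤-from-+ : ∀ {m n} d → m + d ≡ n → m ≤ n
≤-from-+ {m} d refl = m≤m+n m d

+-suc-≰ : ∀ {m n} d → m ≡ n + suc d → ¬ m ≤ n
+-suc-≰ {n = n} d refl = m+1+n≰m n

even-or-odd : ∀ y → (∃[ r ] (y ≡ 2 * r)) ⊎ (∃[ r ] (y ≡ 2 * r + 1))
even-or-odd zero = inj₁ (0 , refl)
even-or-odd (suc y) with even-or-odd y
... | inj₁ (r , refl) = inj₂ (r , +-comm 1 (2 * r))
... | inj₂ (r , refl) = inj₁ (suc r , 2r+2≡2[1+r] r)
  where
    2r+2≡2[1+r] : ∀ r → suc (2 * r + 1) ≡ 2 * suc r
    2r+2≡2[1+r] = solve-∀

quotient-< : ∀ A {i i′ y} y′ → y < A → i < i′ → i * A + y < i′ * A + y′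
quotient-< A {i} {i′} {y} y′ y<A i<i′ = begin-strict
  i * A + y   <⟨ +-monoʳ-< (i * A) y<A ⟩
  i * A + A   ≡⟨ +-comm (i * A) A ⟩
  suc i * A   ≤⟨ *-monoˡ-≤ A i<i′ ⟩
  i′ * A      ≤⟨ m≤m+n (i′ * A) y′ ⟩
  i′ * A + y′ ∎
  where open ≤-Reasoning

divMod-unique : ∀ A i y i′ y′ → y < A → y′ < A → i * A + y ≡ i′ * A + y′ →
                i ≡ i′ × y ≡ y′
divMod-unique A i y i′ y′ y<A y′<A eq with <-cmp i i′
... | tri≈ _ refl _  = refl , +-cancelˡ-≡ (i * A) y y′ eq
... | tri< i<i′ _ _  = ⊥-elim (<-irrefl eq (quotient-< A y′ y<A i<i′))
... | tri> _ _ i′<i = ⊥-elim (<-irrefl (sym eq) (quotient-< A y y′<A i′<i))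

divMod-unique₂ : ∀ A i y i′ y′ → y < A → y′ < A + A → i * A + y ≡ i′ * A + y′ →
                 (i ≡ i′ × y ≡ y′) ⊎ (i ≡ suc i′ × y + A ≡ y′)
divMod-unique₂ A i y i′ y′ y<A y′<2A eq with y′ <? A
... | yes y′<A = inj₁ (divMod-unique A i y i′ y′ y<A y′<A eq)
... | no  y′≮A with m≤n⇒∃[o]m+o≡n (≮⇒≥ y′≮A)
...   | o , refl with divMod-unique A i y (suc i′) o y<A (+-cancelˡ-< A o A y′<2A) (trans eq (shift A i′ o))
  where
    shift : ∀ A i o → i * A + (A + o) ≡ suc i * A + o
    shift = solve-∀
...     | refl , refl = inj₂ (refl , +-comm y A)

anyAtMost? : {P : Pred} → (∀ n → Dec (P n)) → ∀ m → Dec (∃[ n ] (n ≤ m × P n))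
anyAtMost? P? m = map′ (λ (n , n<1+m , p) → n , s≤s⁻¹ n<1+m , p)
                       (λ (n , n≤m , p) → n , s≤s n≤m , p)
                       (anyUpTo? P? (suc m))

2s<2n+1⇒s≤n : ∀ s n → 2 * s < 2 * n + 1 → s ≤ n
2s<2n+1⇒s≤n s n lt = *-cancelˡ-≤ 2 (s≤s⁻¹ (subst (suc (2 * s) ≤_) (+-comm (2 * n) 1) lt))

2s+1<2n+1⇒s<n : ∀ s n → 2 * s + 1 < 2 * n + 1 → s < n
2s+1<2n+1⇒s<n s n lt = *-cancelˡ-< 2 s n (+-cancelʳ-< 1 (2 * s) (2 * n) lt)

n+3≰n+2 : ∀ n {m} → n + 3 ≤ m → m ≤ n + 2 → ⊥
n+3≰n+2 n le₁ le₂ with +-cancelˡ-≤ n 3 2 (≤-trans le₁ le₂)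
... | s≤s (s≤s ())

generated-+ : ∀ gs x y → Generated gs x → Generated gs y → Generated gs (x + y)
generated-+ []       x y refl refl = refl
generated-+ (g ∷ gs) x y (m , x′ , x′∈ , refl) (n , y′ , y′∈ , refl) =
  m + n , x′ + y′ , generated-+ gs x′ y′ x′∈ y′∈ , shuffle m n g x′ y′
  where
    shuffle : ∀ m n g x y → m * g + x + (n * g + y) ≡ (m + n) * g + (x + y)
    shuffle = solve-∀

-- Residues modulo 3

data ℤ₃ : Set where
  0₃ 1₃ 2₃ : ℤ₃

suc₃ : ℤ₃ → ℤ₃
suc₃ 0₃ = 1₃
suc₃ 1₃ = 2₃
suc₃ 2₃ = 0₃

res₃ : ℕ → ℤ₃
res₃ zero    = 0₃
res₃ (suc n) = suc₃ (res₃ n)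

toℕ₃ : ℤ₃ → ℕ
toℕ₃ 0₃ = 0
toℕ₃ 1₃ = 1
toℕ₃ 2₃ = 2

suc₃-cycle : ∀ r → suc₃ (suc₃ (suc₃ r)) ≡ r
suc₃-cycle 0₃ = refl
suc₃-cycle 1₃ = refl
suc₃-cycle 2₃ = refl

n%3≡toℕ₃[res₃n] : ∀ n → n % 3 ≡ toℕ₃ (res₃ n)
n%3≡toℕ₃[res₃n] 0 = refl
n%3≡toℕ₃[res₃n] 1 = refl
n%3≡toℕ₃[res₃n] 2 = refl
n%3≡toℕ₃[res₃n] (suc (suc (suc n))) = begin
  (3 + n) % 3         ≡⟨ cong (_% 3) (+-comm 3 n) ⟩
  (n + 1 * 3) % 3     ≡⟨ [m+kn]%n≡m%n n 1 3 ⟩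
  n % 3               ≡⟨ n%3≡toℕ₃[res₃n] n ⟩
  toℕ₃ (res₃ n)       ≡⟨ cong toℕ₃ (suc₃-cycle (res₃ n)) ⟨
  toℕ₃ (res₃ (3 + n)) ∎
  where open ≡-Reasoning

infixl 6 _+₃_
infixl 7 _*₃_

_+₃_ : ℤ₃ → ℤ₃ → ℤ₃
0₃ +₃ s = s
1₃ +₃ s = suc₃ s
2₃ +₃ s = suc₃ (suc₃ s)

_*₃_ : ℤ₃ → ℤ₃ → ℤ₃
0₃ *₃ s = 0₃
1₃ *₃ s = s
2₃ *₃ s = s +₃ s

-₃_ : ℤ₃ → ℤ₃
-₃ 0₃ = 0₃
-₃ 1₃ = 2₃
-₃ 2₃ = 1₃

suc₃-+₃ : ∀ a b → suc₃ a +₃ b ≡ suc₃ (a +₃ b)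
suc₃-+₃ 0₃ b = refl
suc₃-+₃ 1₃ b = refl
suc₃-+₃ 2₃ b = sym (suc₃-cycle b)

suc₃-*₃ : ∀ a b → suc₃ a *₃ b ≡ b +₃ a *₃ b
suc₃-*₃ 0₃ 0₃ = refl
suc₃-*₃ 0₃ 1₃ = refl
suc₃-*₃ 0₃ 2₃ = refl
suc₃-*₃ 1₃ 0₃ = refl
suc₃-*₃ 1₃ 1₃ = refl
suc₃-*₃ 1₃ 2₃ = refl
suc₃-*₃ 2₃ 0₃ = refl
suc₃-*₃ 2₃ 1₃ = refl
suc₃-*₃ 2₃ 2₃ = refl

+₃-inverseʳ-unique : ∀ a b → a +₃ b ≡ 0₃ → b ≡ -₃ a
+₃-inverseʳ-unique 0₃ 0₃ _ = refl
+₃-inverseʳ-unique 1₃ 2₃ _ = refl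
+₃-inverseʳ-unique 2₃ 1₃ _ = refl
+₃-inverseʳ-unique 0₃ 1₃ ()
+₃-inverseʳ-unique 0₃ 2₃ ()
+₃-inverseʳ-unique 1₃ 0₃ ()
+₃-inverseʳ-unique 1₃ 1₃ ()
+₃-inverseʳ-unique 2₃ 0₃ ()
+₃-inverseʳ-unique 2₃ 2₃ ()

res₃-+ : ∀ m n → res₃ (m + n) ≡ res₃ m +₃ res₃ n
res₃-+ zero    n = refl
res₃-+ (suc m) n = trans (cong suc₃ (res₃-+ m n)) (sym (suc₃-+₃ (res₃ m) (res₃ n)))

res₃-* : ∀ m n → res₃ (m * n) ≡ res₃ m *₃ res₃ n
res₃-* zero    n = refl
res₃-* (suc m) n = begin
  res₃ (n + m * n)             ≡⟨ res₃-+ n (m * n) ⟩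
  res₃ n +₃ res₃ (m * n)       ≡⟨ cong (res₃ n +₃_) (res₃-* m n) ⟩
  res₃ n +₃ res₃ m *₃ res₃ n   ≡⟨ suc₃-*₃ (res₃ m) (res₃ n) ⟨
  suc₃ (res₃ m) *₃ res₃ n      ∎
  where open ≡-Reasoning

-- Since res₃ does not reduce on
-- open terms, the residue of a term is computed by evaluating it in ℤ₃; every
-- multiple of 3 of k then vanishes definitionally.
infixl 6 _:+_
infixl 7 _:*_

data Expr : Set where
  lit     : ℕ → Expr
  jv kv   : Expr
  _:+_ _:*_ : Expr → Expr → Expr

⟦_⟧ : Expr → ℕ → ℕ → ℕ
⟦ lit n ⟧  j k = n
⟦ jv ⟧     j k = j
⟦ kv ⟧     j k = k
⟦ e :+ f ⟧ j k = ⟦ e ⟧ j k + ⟦ f ⟧ j k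
⟦ e :* f ⟧ j k = ⟦ e ⟧ j k * ⟦ f ⟧ j k

⟦_⟧₃ : Expr → ℤ₃ → ℤ₃ → ℤ₃
⟦ lit n ⟧₃  ι κ = res₃ n
⟦ jv ⟧₃     ι κ = ι
⟦ kv ⟧₃     ι κ = κ
⟦ e :+ f ⟧₃ ι κ = ⟦ e ⟧₃ ι κ +₃ ⟦ f ⟧₃ ι κ
⟦ e :* f ⟧₃ ι κ = ⟦ e ⟧₃ ι κ *₃ ⟦ f ⟧₃ ι κ

res₃-⟦⟧ : ∀ e j k {ι} → res₃ j ≡ ι → res₃ (⟦ e ⟧ j k) ≡ ⟦ e ⟧₃ ι (res₃ k)
res₃-⟦⟧ (lit n)  j k hj = refl
res₃-⟦⟧ jv       j k hj = hj
res₃-⟦⟧ kv       j k hj = refl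
res₃-⟦⟧ (e :+ f) j k hj =
  trans (res₃-+ (⟦ e ⟧ j k) (⟦ f ⟧ j k)) (cong₂ _+₃_ (res₃-⟦⟧ e j k hj) (res₃-⟦⟧ f j k hj))
res₃-⟦⟧ (e :* f) j k hj =
  trans (res₃-* (⟦ e ⟧ j k) (⟦ f ⟧ j k)) (cong₂ _*₃_ (res₃-⟦⟧ e j k hj) (res₃-⟦⟧ f j k hj))

-- The residues met so far in the current block of three consecutive elements;
-- a block that has met two residues is recorded by the residue it still lacks.
data Block : Set where
  empty  : Block
  single : ℤ₃ → Block
  lacks  : ℤ₃ → Block

third : ℤ₃ → ℤ₃ → ℤ₃
third 0₃ 1₃ = 2₃
third 1₃ 0₃ = 2₃
third 0₃ 2₃ = 1₃
third 2₃ 0₃ = 1₃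
third 1₃ 2₃ = 0₃
third 2₃ 1₃ = 0₃
third r  _  = r

push : ℤ₃ → Block → Block
push r empty      = single r
push r (single s) = lacks (third r s)
push r (lacks _)  = empty

Fresh : ℤ₃ → Block → Set
Fresh r empty      = ⊤
Fresh r (single s) = ¬ r ≡ s
Fresh r (lacks m)  = r ≡ m

-- The block at an element of residue ρ inside a run along which residues advance
-- by δ, when s elements (mod 3) have been scanned so far.
run : ℤ₃ → ℤ₃ → ℤ₃ → Block
run δ ρ 0₃ = empty
run δ ρ 1₃ = single ρ
run δ ρ 2₃ = lacks (δ +₃ ρ)

run-step : ∀ δ ρ s → ¬ δ ≡ 0₃ →
           Fresh (δ +₃ ρ) (run δ ρ s) × push (δ +₃ ρ) (run δ ρ s) ≡ run δ (δ +₃ ρ) (suc₃ s)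
run-step 0₃ ρ  s  δ≢0 = ⊥-elim (δ≢0 refl)
run-step 1₃ ρ  0₃ _ = tt , refl
run-step 2₃ ρ  0₃ _ = tt , refl
run-step 1₃ 0₃ 1₃ _ = (λ ()) , refl
run-step 1₃ 1₃ 1₃ _ = (λ ()) , refl
run-step 1₃ 2₃ 1₃ _ = (λ ()) , refl
run-step 2₃ 0₃ 1₃ _ = (λ ()) , refl
run-step 2₃ 1₃ 1₃ _ = (λ ()) , refl
run-step 2₃ 2₃ 1₃ _ = (λ ()) , refl
run-step 1₃ ρ  2₃ _ = refl , refl
run-step 2₃ ρ  2₃ _ = refl , refl

data Permutation₃ : ℤ₃ → ℤ₃ → ℤ₃ → Set where
  p012 : Permutation₃ 0₃ 1₃ 2₃
  p021 : Permutation₃ 0₃ 2₃ 1₃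
  p102 : Permutation₃ 1₃ 0₃ 2₃
  p120 : Permutation₃ 1₃ 2₃ 0₃
  p201 : Permutation₃ 2₃ 0₃ 1₃
  p210 : Permutation₃ 2₃ 1₃ 0₃

distinct-permutation₃ : ∀ u v → ¬ v ≡ u → Permutation₃ u v (third v u)
distinct-permutation₃ 0₃ 1₃ _ = p012
distinct-permutation₃ 0₃ 2₃ _ = p021
distinct-permutation₃ 1₃ 0₃ _ = p102
distinct-permutation₃ 1₃ 2₃ _ = p120
distinct-permutation₃ 2₃ 0₃ _ = p201
distinct-permutation₃ 2₃ 1₃ _ = p210
distinct-permutation₃ 0₃ 0₃ v≢u = ⊥-elim (v≢u refl)
distinct-permutation₃ 1₃ 1₃ v≢u = ⊥-elim (v≢u refl)
distinct-permutation₃ 2₃ 2₃ v≢u = ⊥-elim (v≢u refl)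

triple : ℤ₃ → ℤ₃ → ℤ₃ → Fin 3 → ℤ₃
triple u v w 0F = u
triple u v w 1F = v
triple u v w 2F = w

permutation₃-exactlyOne : ∀ {u v w} → Permutation₃ u v w → (ρ : Fin 3) →
                          ExactlyOne (λ i → toℕ₃ (triple u v w i) ≡ toℕ ρ)
permutation₃-exactlyOne p012 0F = 0F , refl , λ { 0F _ → refl ; 1F () ; 2F () }
permutation₃-exactlyOne p012 1F = 1F , refl , λ { 0F () ; 1F _ → refl ; 2F () }
permutation₃-exactlyOne p012 2F = 2F , refl , λ { 0F () ; 1F () ; 2F _ → refl }
permutation₃-exactlyOne p021 0F = 0F , refl , λ { 0F _ → refl ; 1F () ; 2F () }
permutation₃-exactlyOne p021 1F = 2F , refl , λ { 0F () ; 1F () ; 2F _ → refl }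
permutation₃-exactlyOne p021 2F = 1F , refl , λ { 0F () ; 1F _ → refl ; 2F () }
permutation₃-exactlyOne p102 0F = 1F , refl , λ { 0F () ; 1F _ → refl ; 2F () }
permutation₃-exactlyOne p102 1F = 0F , refl , λ { 0F _ → refl ; 1F () ; 2F () }
permutation₃-exactlyOne p102 2F = 2F , refl , λ { 0F () ; 1F () ; 2F _ → refl }
permutation₃-exactlyOne p120 0F = 2F , refl , λ { 0F () ; 1F () ; 2F _ → refl }
permutation₃-exactlyOne p120 1F = 0F , refl , λ { 0F _ → refl ; 1F () ; 2F () }
permutation₃-exactlyOne p120 2F = 1F , refl , λ { 0F () ; 1F _ → refl ; 2F () }
permutation₃-exactlyOne p201 0F = 1F , refl , λ { 0F () ; 1F _ → refl ; 2F () }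
permutation₃-exactlyOne p201 1F = 2F , refl , λ { 0F () ; 1F () ; 2F _ → refl }
permutation₃-exactlyOne p201 2F = 0F , refl , λ { 0F _ → refl ; 1F () ; 2F () }
permutation₃-exactlyOne p210 0F = 2F , refl , λ { 0F () ; 1F () ; 2F _ → refl }
permutation₃-exactlyOne p210 1F = 1F , refl , λ { 0F () ; 1F _ → refl ; 2F () }
permutation₃-exactlyOne p210 2F = 0F , refl , λ { 0F _ → refl ; 1F () ; 2F () }

-- The increasing enumeration of a decidable set with finite complement

module Enumeration {P : Pred} (P? : ∀ x → Dec (P x)) (P0 : P 0)
                   (c : ℕ) (P-above : ∀ x → c ≤ x → P x) where

  search : ℕ → ℕ → ℕ
  search y zero = y
  search y (suc f) with P? y
  ... | yes _ = y
  ... | no  _ = search (suc y) f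

  search-least : ∀ y f → P (y + f) →
                 y ≤ search y f × P (search y f) × (∀ w → y ≤ w → w < search y f → ¬ P w)
  search-least y zero py+f =
    ≤-refl , subst P (+-identityʳ y) py+f , λ w y≤w w<y _ → <-irrefl refl (≤-<-trans y≤w w<y)
  search-least y (suc f) py+f with P? y
  ... | yes py = ≤-refl , py , λ w y≤w w<y _ → <-irrefl refl (≤-<-trans y≤w w<y)
  ... | no ¬py with search-least (suc y) f (subst P (+-suc y f) py+f)
  ...   | y<s , ps , gap = ≤-trans (n≤1+n y) y<s , ps , gap′
    where
      gap′ : ∀ w → y ≤ w → w < search (suc y) f → ¬ P w
      gap′ w y≤w w<s with y ≟ w
      ... | yes refl = ¬py
      ... | no  y≢w  = gap w (≤∧≢⇒< y≤w y≢w) w<s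

  next : ℕ → ℕ
  next x = search (suc x) c

  next-least : ∀ x → x < next x × P (next x) × (∀ w → x < w → w < next x → ¬ P w)
  next-least x = search-least (suc x) c (P-above _ (≤-trans (m≤n+m c x) (n≤1+n _)))

  next-unique : ∀ x y → x < y → P y → (∀ w → x < w → w < y → ¬ P w) → next x ≡ y
  next-unique x y x<y py gap with next-least x | <-cmp (next x) y
  ... | _   , _  , _    | tri≈ _ e _   = e
  ... | x<z , pz , _    | tri< z<y _ _ = ⊥-elim (gap (next x) x<z z<y pz)
  ... | _   , _  , gapz | tri> _ _ y<z = ⊥-elim (gapz y x<y y<z py)

  enum : ℕ → ℕ
  enum zero    = 0
  enum (suc n) = next (enum n)

  enum-∈ : ∀ n → P (enum n)
  enum-∈ zero    = P0
  enum-∈ (suc n) = proj₁ (proj₂ (next-least (enum n)))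

  enum-< : ∀ n → enum n < enum (suc n)
  enum-< n = proj₁ (next-least (enum n))

  enum-gap : ∀ n w → enum n < w → w < enum (suc n) → ¬ P w
  enum-gap n = proj₂ (proj₂ (next-least (enum n)))

  enum-reaches : ∀ x → P x → ∀ f n → enum n ≤ x → x ≤ enum n + f → ∃[ m ] (enum m ≡ x)
  enum-reaches x px zero n en≤x x≤en = n , ≤-antisym en≤x (subst (x ≤_) (+-identityʳ (enum n)) x≤en)
  enum-reaches x px (suc f) n en≤x x≤en with enum n ≟ x
  ... | yes en≡x = n , en≡x
  ... | no  en≢x = enum-reaches x px f (suc n) en+1≤x x≤en+1
    where
      en+1≤x : enum (suc n) ≤ x
      en+1≤x with enum (suc n) ≤? x
      ... | yes le = le
      ... | no  gt = ⊥-elim (enum-gap n x (≤∧≢⇒< en≤x en≢x) (≰⇒> gt) px)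
      x≤en+1 : x ≤ enum (suc n) + f
      x≤en+1 = ≤-trans x≤en (≤-trans (≤-reflexive (+-suc (enum n) f)) (+-monoˡ-≤ f (enum-< n)))

  enum-surjective : ∀ x → P x → ∃[ m ] (enum m ≡ x)
  enum-surjective x px = enum-reaches x px x 0 z≤n (m≤n+m x 0)

  enum-isEnumeration : IsEnumeration P enum
  enum-isEnumeration = refl , enum-∈ , enum-< , enum-surjective

  -- the block reached after scanning the elements of P in [1, x]
  block : ℕ → Block
  block zero = empty
  block (suc x) with P? (suc x)
  ... | yes _ = push (res₃ (suc x)) (block x)
  ... | no  _ = block x

  block-∈ : ∀ x → P (suc x) → block (suc x) ≡ push (res₃ (suc x)) (block x)
  block-∈ x p with P? (suc x)
  ... | yes _ = refl
  ... | no ¬p = ⊥-elim (¬p p)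

  block-∉ : ∀ x → ¬ P (suc x) → block (suc x) ≡ block x
  block-∉ x ¬p with P? (suc x)
  ... | yes p = ⊥-elim (¬p p)
  ... | no  _ = refl

  Good : ℕ → Set
  Good x = P (suc x) → Fresh (res₃ (suc x)) (block x)

  module _ (good : ∀ x → Good x) where

    block-constant : ∀ n d → enum n + d < enum (suc n) → block (enum n + d) ≡ block (enum n)
    block-constant n zero    _  = cong block (+-identityʳ (enum n))
    block-constant n (suc d) lt = begin
      block (enum n + suc d)   ≡⟨ cong block (+-suc (enum n) d) ⟩
      block (suc (enum n + d)) ≡⟨ block-∉ (enum n + d) (enum-gap n _ (s≤s (m≤m+n (enum n) d)) lt′) ⟩
      block (enum n + d)       ≡⟨ block-constant n d (<-trans (n<1+n _) lt′) ⟩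
      block (enum n)           ∎
      where
        open ≡-Reasoning
        lt′ : suc (enum n + d) < enum (suc n)
        lt′ = subst (_< enum (suc n)) (+-suc (enum n) d) lt

    block-next : ∀ n → Fresh (res₃ (enum (suc n))) (block (enum n))
                     × block (enum (suc n)) ≡ push (res₃ (enum (suc n))) (block (enum n))
    block-next n with m≤n⇒∃[o]m+o≡n (enum-< n)
    ... | d , e = subst₂ (λ y S → Fresh (res₃ y) S) e flat (good z pz)
                , subst (λ y → block y ≡ push (res₃ y) (block (enum n))) e
                        (trans (block-∈ z pz) (cong (push _) flat))
      where
        z = enum n + d
        pz : P (suc z)
        pz = subst P (sym e) (enum-∈ (suc n))
        flat : block z ≡ block (enum n)
        flat = block-constant n d (subst (z <_) e ≤-refl)

    block-empty : ∀ j → block (enum (j * 3)) ≡ empty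
    block-empty zero = refl
    block-empty (suc j) =
      trans (proj₂ (block-next (2 + j * 3))) (cong (push _)
      (trans (proj₂ (block-next (1 + j * 3))) (cong (push _)
      (trans (proj₂ (block-next (j * 3))) (cong (push _) (block-empty j))))))

    block-permutation : ∀ j → Permutation₃ (res₃ (enum (1 + j * 3))) (res₃ (enum (2 + j * 3)))
                                           (res₃ (enum (3 + j * 3)))
    block-permutation j = subst (Permutation₃ u v) (sym w≡) (distinct-permutation₃ u v v≢u)
      where
        u = res₃ (enum (1 + j * 3))
        v = res₃ (enum (2 + j * 3))
        w = res₃ (enum (3 + j * 3))
        block₁ : block (enum (1 + j * 3)) ≡ single u
        block₁ = trans (proj₂ (block-next (j * 3))) (cong (push _) (block-empty j))
        block₂ : block (enum (2 + j * 3)) ≡ lacks (third v u)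
        block₂ = trans (proj₂ (block-next (1 + j * 3))) (cong (push _) block₁)
        v≢u : ¬ v ≡ u
        v≢u = subst (Fresh v) block₁ (proj₁ (block-next (1 + j * 3)))
        w≡ : w ≡ third v u
        w≡ = subst (Fresh w) block₂ (proj₁ (block-next (2 + j * 3)))

    enum-residues : ∀ j (ρ : Fin 3) → ExactlyOne (λ i → enum (j * 3 + toℕ i + 1) % 3 ≡ toℕ ρ)
    enum-residues j ρ with permutation₃-exactlyOne (block-permutation j) ρ
    ... | i , hit , unique = i , trans (residue i) hit , λ i′ h → unique i′ (trans (sym (residue i′)) h)
      where
        shift : ∀ j i → j * 3 + i + 1 ≡ suc i + j * 3
        shift = solve-∀
        residue : ∀ i → enum (j * 3 + toℕ i + 1) % 3
                        ≡ toℕ₃ (triple (res₃ (enum (1 + j * 3))) (res₃ (enum (2 + j * 3)))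
                                       (res₃ (enum (3 + j * 3))) i)
        residue 0F = trans (cong (λ y → enum y % 3) (shift j 0)) (n%3≡toℕ₃[res₃n] (enum (1 + j * 3)))
        residue 1F = trans (cong (λ y → enum y % 3) (shift j 1)) (n%3≡toℕ₃[res₃n] (enum (2 + j * 3)))
        residue 2F = trans (cong (λ y → enum y % 3) (shift j 2)) (n%3≡toℕ₃[res₃n] (enum (3 + j * 3)))

  Reach : ℕ → Block → Set
  Reach x S = (∀ z → z < x → Good z) × block x ≡ S

  good-suc : ∀ {x} → (∀ z → z < x → Good z) → Good x → ∀ z → z < suc x → Good z
  good-suc goods gx z z<1+x with m<1+n⇒m<n∨m≡n z<1+x
  ... | inj₁ z<x  = goods z z<x
  ... | inj₂ refl = gx

  reach-skip : ∀ {x S} → ¬ P (suc x) → Reach x S → Reach (suc x) S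
  reach-skip {x} ¬p (goods , bx) = good-suc goods (λ p → ⊥-elim (¬p p)) , trans (block-∉ x ¬p) bx

  reach-push : ∀ {x S} → P (suc x) → Fresh (res₃ (suc x)) S → Reach x S →
               Reach (suc x) (push (res₃ (suc x)) S)
  reach-push {x} p fresh (goods , bx) =
    good-suc goods (λ _ → subst (Fresh _) (sym bx) fresh) , trans (block-∈ x p) (cong (push _) bx)

  reach-gap : ∀ x d {S} → (∀ t → t < d → ¬ P (suc (x + t))) → Reach x S → Reach (x + d) S
  reach-gap x zero    {S} ¬ps r = subst (λ y → Reach y S) (sym (+-identityʳ x)) r
  reach-gap x (suc d) {S} ¬ps r = subst (λ y → Reach y S) (sym (+-suc x d))
    (reach-skip (¬ps d ≤-refl) (reach-gap x d (λ t t<d → ¬ps t (m<n⇒m<1+n t<d)) r))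

  reach-run₁ : ∀ x d s → (∀ t → t < d → P (suc (x + t))) → Reach x (run 1₃ (res₃ x) s) →
               Reach (x + d) (run 1₃ (res₃ (x + d)) (res₃ d +₃ s))
  reach-run₁ x zero    s _  r = subst (λ y → Reach y (run 1₃ (res₃ y) s)) (sym (+-identityʳ x)) r
  reach-run₁ x (suc d) s ps r =
    subst (λ y → Reach y (run 1₃ (res₃ y) (res₃ (suc d) +₃ s))) (sym (+-suc x d))
      (subst (Reach _) (trans (proj₂ step) (cong (run 1₃ _) (sym (suc₃-+₃ (res₃ d) s))))
        (reach-push (ps d ≤-refl) (proj₁ step)
          (reach-run₁ x d s (λ t t<d → ps t (m<n⇒m<1+n t<d)) r)))
    where step = run-step 1₃ (res₃ (x + d)) (res₃ d +₃ s) (λ ())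

  reach-run₂ : ∀ x m s → (∀ t → t < m → ¬ P (suc (x + 2 * t))) →
               (∀ t → t < m → P (2 + (x + 2 * t))) →
               Reach x (run 2₃ (res₃ x) s) → Reach (x + 2 * m) (run 2₃ (res₃ (x + 2 * m)) (res₃ m +₃ s))
  reach-run₂ x zero    s _   _  r = subst (λ y → Reach y (run 2₃ (res₃ y) s)) (sym (+-identityʳ x)) r
  reach-run₂ x (suc m) s ¬ps ps r =
    subst (λ y → Reach y (run 2₃ (res₃ y) (res₃ (suc m) +₃ s))) (sym (x+2[1+m] x m))
      (subst (Reach _) (trans (proj₂ step) (cong (run 2₃ _) (sym (suc₃-+₃ (res₃ m) s))))
        (reach-push (ps m ≤-refl) (proj₁ step)
          (reach-skip (¬ps m ≤-refl)
            (reach-run₂ x m s (λ t t<m → ¬ps t (m<n⇒m<1+n t<m)) (λ t t<m → ps t (m<n⇒m<1+n t<m)) r))))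
    where
      step = run-step 2₃ (res₃ (x + 2 * m)) (res₃ m +₃ s) (λ ())
      x+2[1+m] : ∀ x m → x + 2 * suc m ≡ 2 + (x + 2 * m)
      x+2[1+m] = solve-∀

  all-good : ∀ x s → (∀ t → P (suc (x + t))) → Reach x (run 1₃ (res₃ x) s) → ∀ z → Good z
  all-good x s ps r z =
    proj₁ (reach-run₁ x (suc z) s (λ t _ → ps t) r) z (<-≤-trans (n<1+n z) (m≤n+m (suc z) x))

-- The semigroup ⟨a, b, c⟩ and its parametrisation

module Generators (k : ℕ) where

  a/2≡ : aₖ k / 2 ≡ 6 * k + 4
  a/2≡ = trans (cong (_/ 2) (a≡ k)) (m*n/n≡m (6 * k + 4) 2)
    where
      a≡ : ∀ k → 12 * k + 8 ≡ (6 * k + 4) * 2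
      a≡ = solve-∀

  c≡ : cₖ k ≡ 18 * k + 15
  c≡ = trans (cong (bₖ k +_) (trans (cong (_/ 2) (b≡ k)) (m*n/n≡m (6 * k + 5) 2))) (b+b/2≡ k)
    where
      b≡ : ∀ k → 12 * k + 8 + 2 ≡ (6 * k + 5) * 2
      b≡ = solve-∀
      b+b/2≡ : ∀ k → 12 * k + 8 + 2 + (6 * k + 5) ≡ 18 * k + 15
      b+b/2≡ = solve-∀

  rep : ℕ → ℕ → ℕ → ℕ → ℕ
  rep q r v ε = (q + 3 * v + ε) * aₖ k + ε * (6 * k + 4) + 6 * v + 3 * ε + 2 * r

  Param : Pred
  Param x = ∃[ q ] ∃[ r ] ∃[ v ] ∃[ ε ] (ε ≤ 1 × r ≤ q ×
              x ≡ (q + 3 * v + ε) * aₖ k + ε * (aₖ k / 2) + 6 * v + 3 * ε + 2 * r)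

  param : ∀ {x} q r v ε → ε ≤ 1 → r ≤ q → x ≡ rep q r v ε → Param x
  param q r v ε ε≤1 r≤q x≡ = q , r , v , ε , ε≤1 , r≤q ,
    trans x≡ (cong (λ h → (q + 3 * v + ε) * aₖ k + ε * h + 6 * v + 3 * ε + 2 * r) (sym a/2≡))

  unparam : ∀ {x} q r v ε → x ≡ (q + 3 * v + ε) * aₖ k + ε * (aₖ k / 2) + 6 * v + 3 * ε + 2 * r →
            x ≡ rep q r v ε
  unparam q r v ε x≡ =
    trans x≡ (cong (λ h → (q + 3 * v + ε) * aₖ k + ε * h + 6 * v + 3 * ε + 2 * r) a/2≡)

  -- Since 2c = 3a + 6, a multiple 2v + ε of c contributes 3v + ε copies of a.
  combination≡rep : ∀ k m n v ε →
    m * (12 * k + 8) + (n * (12 * k + 8 + 2) + ((ε + 2 * v) * (18 * k + 15) + 0))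
    ≡ (m + n + 3 * v + ε) * (12 * k + 8) + ε * (6 * k + 4) + 6 * v + 3 * ε + 2 * n
  combination≡rep = solve-∀

  generated⇒param : ∀ x → Gₖ k x → Param x
  generated⇒param x (m , _ , (n , _ , (l , _ , refl , refl) , refl) , refl) =
    param (m + n) n (l / 2) (l % 2) (m<1+n⇒m≤n (m%n<n l 2)) (m≤n+m n m) (begin
      m * aₖ k + (n * bₖ k + (l * cₖ k + 0))
        ≡⟨ cong₂ (λ l′ c → m * aₖ k + (n * bₖ k + (l′ * c + 0))) (m≡m%n+[m/n]*n l 2) c≡ ⟩
      m * aₖ k + (n * bₖ k + ((l % 2 + l / 2 * 2) * (18 * k + 15) + 0))
        ≡⟨ cong (λ e → m * aₖ k + (n * bₖ k + ((l % 2 + e) * (18 * k + 15) + 0))) (*-comm (l / 2) 2) ⟩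
      m * aₖ k + (n * bₖ k + ((l % 2 + 2 * (l / 2)) * (18 * k + 15) + 0))
        ≡⟨ combination≡rep k m n (l / 2) (l % 2) ⟩
      rep (m + n) n (l / 2) (l % 2) ∎)
    where open ≡-Reasoning

  param⇒generated : ∀ x → Param x → Gₖ k x
  param⇒generated x (q , r , v , ε , _ , r≤q , x≡) =
    q ∸ r , _ , (r , _ , (ε + 2 * v , 0 , refl , refl) , refl) , (begin
      x                     ≡⟨ unparam q r v ε x≡ ⟩
      rep q r v ε           ≡⟨ cong (λ q′ → rep q′ r v ε) (sym (m∸n+n≡m r≤q)) ⟩
      rep (q ∸ r + r) r v ε ≡⟨ combination≡rep k (q ∸ r) r v ε ⟨
      (q ∸ r) * aₖ k + (r * bₖ k + ((ε + 2 * v) * (18 * k + 15) + 0))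
        ≡⟨ cong (λ c → (q ∸ r) * aₖ k + (r * bₖ k + ((ε + 2 * v) * c + 0))) (sym c≡) ⟩
      (q ∸ r) * aₖ k + (r * bₖ k + ((ε + 2 * v) * cₖ k + 0))  ∎)
    where open ≡-Reasoning

  generated⇔param : ∀ x → Gₖ k x ⇔ Param x
  generated⇔param x = mk⇔ (generated⇒param x) (param⇒generated x)

-- H₁₅ and the parametrisation

module Membership (k : ℕ) where
  open Generators k

  conductor : ℕ
  conductor = (6 * k + 4) * aₖ k + (6 * k + 4) + 3

  conductor≡ : (6 * k + 4) * aₖ k + aₖ k / 2 + 3 ≡ conductor
  conductor≡ = cong (λ h → (6 * k + 4) * aₖ k + h + 3) a/2≡

  ∈-tail : ∀ {x} → conductor ≤ x → H15 k x
  ∈-tail {x} c≤x = inj₂ (subst (_≤ x) (sym conductor≡) c≤x)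

  a≡2[a/2] : aₖ k ≡ 2 * (6 * k + 4)
  a≡2[a/2] = 12k+8≡2[6k+4] k
    where
      12k+8≡2[6k+4] : ∀ k → 12 * k + 8 ≡ 2 * (6 * k + 4)
      12k+8≡2[6k+4] = solve-∀

  window-<-conductor : ∀ i y → i < 6 * k + 4 → y < aₖ k → i * aₖ k + y < conductor
  window-<-conductor i y i< y<a = begin-strict
    i * aₖ k + y             <⟨ +-monoʳ-< (i * aₖ k) y<a ⟩
    i * aₖ k + aₖ k          ≡⟨ +-comm (i * aₖ k) (aₖ k) ⟩
    suc i * aₖ k             ≤⟨ *-monoˡ-≤ (aₖ k) i< ⟩
    (6 * k + 4) * aₖ k       ≤⟨ m≤m+n _ (6 * k + 4 + 3) ⟩
    (6 * k + 4) * aₖ k + (6 * k + 4 + 3) ≡⟨ +-assoc ((6 * k + 4) * aₖ k) (6 * k + 4) 3 ⟨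
    conductor                ∎
    where open ≤-Reasoning

  below-conductor : ∀ i y → i ≤ 6 * k + 4 → y ≤ 6 * k + 6 → i * aₖ k + y < conductor
  below-conductor i y i≤ y≤ = subst (i * aₖ k + y <_) (sym (+-assoc ((6 * k + 4) * aₖ k) (6 * k + 4) 3))
    (+-mono-≤-< (*-monoˡ-≤ (aₖ k) i≤) (subst (suc y ≤_) (1+[6k+6]≡6k+4+3 k) (s≤s y≤)))
    where
      1+[6k+6]≡6k+4+3 : ∀ k → suc (6 * k + 6) ≡ 6 * k + 4 + 3
      1+[6k+6]≡6k+4+3 = solve-∀

  conductor-≤-window : ∀ i y → 6 * k + 4 < i → conductor ≤ i * aₖ k + y
  conductor-≤-window i y 6k+4<i = begin
    conductor                ≤⟨ ≤-from-+ (6 * k + 1) (conductor+[6k+1]≡[6k+5]a k) ⟩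
    suc (6 * k + 4) * aₖ k   ≤⟨ *-monoˡ-≤ (aₖ k) 6k+4<i ⟩
    i * aₖ k                 ≤⟨ m≤m+n _ y ⟩
    i * aₖ k + y             ∎
    where
      open ≤-Reasoning
      conductor+[6k+1]≡[6k+5]a : ∀ k → (6 * k + 4) * (12 * k + 8) + (6 * k + 4) + 3 + (6 * k + 1)
                    ≡ suc (6 * k + 4) * (12 * k + 8)
      conductor+[6k+1]≡[6k+5]a = solve-∀

  ∈A : ∀ i h → h ≤ i → H15 k (i * aₖ k + 2 * h)
  ∈A zero    .zero z≤n = inj₁ (0 , z≤n , inj₁ refl)
  ∈A (suc j) h h≤i with suc j ≤? 6 * k + 4
  ... | yes i≤ = inj₁ (suc j , i≤ , inj₁ (h , h≤i , refl))
  ... | no  i≰ = ∈-tail (conductor-≤-window (suc j) (2 * h) (≰⇒> i≰))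

  ∈B : ∀ j h → h ≤ j → H15 k (suc j * aₖ k + (6 * k + 4) + 3 + 2 * h)
  ∈B j h h≤j with suc j ≤? 6 * k + 4
  ... | yes i≤ =
    inj₁ (suc j , i≤ , inj₂ (h , h≤j , cong (λ z → suc j * aₖ k + z + 3 + 2 * h) (sym a/2≡)))
  ... | no  i≰ = ∈-tail (subst (conductor ≤_) (assoc (suc j * aₖ k) (6 * k + 4) 3 (2 * h))
                                (conductor-≤-window (suc j) (6 * k + 4 + 3 + 2 * h) (≰⇒> i≰)))
    where
      assoc : ∀ a b c d → a + (b + c + d) ≡ a + b + c + d
      assoc = solve-∀

  H15? : ∀ x → Dec (H15 k x)
  H15? x = anyAtMost? (λ i → A? i ⊎-dec B? i) (6 * k + 4) ⊎-dec ((6 * k + 4) * aₖ k + aₖ k / 2 + 3 ≤? x)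
    where
      A? : ∀ i → Dec (A k i x)
      A? zero    = x ≟ 0
      A? (suc j) = anyAtMost? (λ h → x ≟ suc j * aₖ k + 2 * h) (suc j)
      B? : ∀ i → Dec (B k i x)
      B? zero    = no λ ()
      B? (suc j) = anyAtMost? (λ h → x ≟ suc j * aₖ k + aₖ k / 2 + 3 + 2 * h) j

  3v+r≤q+3v : ∀ {r q} v → r ≤ q → 3 * v + r ≤ q + 3 * v
  3v+r≤q+3v {q = q} v r≤q = ≤-trans (+-monoʳ-≤ (3 * v) r≤q) (≤-reflexive (+-comm (3 * v) q))

  param⇒H15 : ∀ x → Param x → H15 k x
  param⇒H15 x (q , r , v , .0 , z≤n , r≤q , x≡) =
    subst (H15 k) (sym (trans (unparam q r v 0 x≡) (in-A k q v r)))
          (∈A (q + 3 * v) (3 * v + r) (3v+r≤q+3v v r≤q))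
    where
      in-A : ∀ k q v r → (q + 3 * v + 0) * (12 * k + 8) + 0 * (6 * k + 4) + 6 * v + 3 * 0 + 2 * r
                         ≡ (q + 3 * v) * (12 * k + 8) + 2 * (3 * v + r)
      in-A = solve-∀
  param⇒H15 x (q , r , v , .1 , s≤s z≤n , r≤q , x≡) =
    subst (H15 k) (sym (trans (unparam q r v 1 x≡) (in-B k q v r)))
          (∈B (q + 3 * v) (3 * v + r) (3v+r≤q+3v v r≤q))
    where
      in-B : ∀ k q v r → (q + 3 * v + 1) * (12 * k + 8) + 1 * (6 * k + 4) + 6 * v + 3 * 1 + 2 * r
                         ≡ suc (q + 3 * v) * (12 * k + 8) + (6 * k + 4) + 3 + 2 * (3 * v + r)
      in-B = solve-∀

  r≤3k+2 : ∀ {r} → r < 3 * k + 3 → r ≤ 3 * k + 2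
  r≤3k+2 {r} r< = ≤-pred (subst (suc r ≤_) (+-suc (3 * k) 2) r<)

  even-tail-param : ∀ t r → 2 * r < aₖ k → Param ((6 * k + 4 + t) * aₖ k + 2 * r)
  even-tail-param t r 2r<a = param (6 * k + 4 + t) r 0 0 z≤n (≤-trans (<⇒≤ r<) (m≤m+n _ t)) (rep≡ k t r)
    where
      r< : r < 6 * k + 4
      r< = *-cancelˡ-< 2 r (6 * k + 4) (subst (2 * r <_) a≡2[a/2] 2r<a)
      rep≡ : ∀ k t r → (6 * k + 4 + t) * (12 * k + 8) + 2 * r
                       ≡ (6 * k + 4 + t + 3 * 0 + 0) * (12 * k + 8) + 0 * (6 * k + 4) + 6 * 0 + 3 * 0 + 2 * r
      rep≡ = solve-∀

  odd-high-tail-param : ∀ t s → 2 * (3 * k + 3 + s) + 1 < aₖ k →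
                        Param ((6 * k + 4 + t) * aₖ k + (2 * (3 * k + 3 + s) + 1))
  odd-high-tail-param t s y<a = param (6 * k + 3 + t) s 0 1 (s≤s z≤n) s≤ (rep≡ k t s)
    where
      3k+3+s≤6k+3 : 3 * k + 3 + s ≤ 6 * k + 3
      3k+3+s≤6k+3 = ≤-pred (subst (suc (3 * k + 3 + s) ≤_) (+-suc (6 * k) 3)
                      (*-cancelˡ-< 2 _ (6 * k + 4) (subst (2 * (3 * k + 3 + s) <_) a≡2[a/2]
                        (≤-trans (s≤s (m≤m+n _ 1)) y<a))))
      s≤ : s ≤ 6 * k + 3 + t
      s≤ = ≤-trans (m≤n+m s (3 * k + 3)) (≤-trans 3k+3+s≤6k+3 (m≤m+n _ t))
      rep≡ : ∀ k t s → (6 * k + 4 + t) * (12 * k + 8) + (2 * (3 * k + 3 + s) + 1)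
                       ≡ (6 * k + 3 + t + 3 * 0 + 1) * (12 * k + 8) + 1 * (6 * k + 4) + 6 * 0 + 3 * 1 + 2 * s
      rep≡ = solve-∀

  odd-low-tail-param : ∀ t r → r < 3 * k + 3 → conductor ≤ (6 * k + 4 + t) * aₖ k + (2 * r + 1) →
                       Param ((6 * k + 4 + t) * aₖ k + (2 * r + 1))
  odd-low-tail-param zero r r< c≤ =
    ⊥-elim (+-suc-≰ 1 (6k+7≡2[3k+2]+1+2 k) (≤-trans 6k+7≤2r+1 (+-monoˡ-≤ 1 (*-monoʳ-≤ 2 (r≤3k+2 r<)))))
    where
      6k+7≤2r+1 : 6 * k + 4 + 3 ≤ 2 * r + 1
      6k+7≤2r+1 = +-cancelˡ-≤ ((6 * k + 4) * aₖ k) _ _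
        (subst₂ _≤_ (+-assoc ((6 * k + 4) * aₖ k) (6 * k + 4) 3)
                    (cong (λ i → i * aₖ k + (2 * r + 1)) (+-identityʳ (6 * k + 4))) c≤)
      6k+7≡2[3k+2]+1+2 : ∀ k → 6 * k + 4 + 3 ≡ 2 * (3 * k + 2) + 1 + suc 1
      6k+7≡2[3k+2]+1+2 = solve-∀
  odd-low-tail-param (suc t) r r< _ =
    param (6 * k + 3 + t) (3 * k + 1 + r) 0 1 (s≤s z≤n)
          (≤-trans (+-monoʳ-≤ (3 * k + 1) (r≤3k+2 r<)) (≤-trans (≤-reflexive (3k+1+[3k+2]≡6k+3 k)) (m≤m+n _ t)))
          (rep≡ k t r)
    where
      3k+1+[3k+2]≡6k+3 : ∀ k → 3 * k + 1 + (3 * k + 2) ≡ 6 * k + 3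
      3k+1+[3k+2]≡6k+3 = solve-∀
      rep≡ : ∀ k t r → (6 * k + 4 + suc t) * (12 * k + 8) + (2 * r + 1)
                       ≡ (6 * k + 3 + t + 3 * 0 + 1) * (12 * k + 8) + 1 * (6 * k + 4) + 6 * 0 + 3 * 1
                         + 2 * (3 * k + 1 + r)
      rep≡ = solve-∀

  window-tail-param : ∀ i y → y < aₖ k → conductor ≤ i * aₖ k + y → Param (i * aₖ k + y)
  window-tail-param i y y<a c≤ with 6 * k + 4 ≤? i
  ... | no  i≱ = ⊥-elim (<⇒≱ (window-<-conductor i y (≰⇒> i≱) y<a) c≤)
  ... | yes i≥ with m≤n⇒∃[o]m+o≡n i≥ | even-or-odd y
  ...   | t , refl | inj₁ (r , refl) = even-tail-param t r y<a
  ...   | t , refl | inj₂ (r , refl) with 3 * k + 3 ≤? r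
  ...     | no  r≱ = odd-low-tail-param t r (≰⇒> r≱) c≤
  ...     | yes r≥ with m≤n⇒∃[o]m+o≡n r≥
  ...       | s , refl = odd-high-tail-param t s y<a

  -- the divisor is written 8 + 12 k so that its NonZero instance is found
  tail-param : ∀ x → conductor ≤ x → Param x
  tail-param x c≤x = subst Param (sym x≡) (window-tail-param q r r<a (subst (conductor ≤_) x≡ c≤x))
    where
      q = x / (8 + 12 * k)
      r = x % (8 + 12 * k)
      r<a : r < aₖ k
      r<a = subst (r <_) (+-comm 8 (12 * k)) (m%n<n x (8 + 12 * k))
      x≡ : x ≡ q * aₖ k + r
      x≡ = trans (m≡m%n+[m/n]*n x (8 + 12 * k))
                 (trans (+-comm r (q * (8 + 12 * k))) (cong (λ a → q * a + r) (+-comm 8 (12 * k))))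

  H15⇒param : ∀ x → H15 k x → Param x
  H15⇒param x (inj₁ (zero , _ , inj₁ x≡0)) = 0 , 0 , 0 , 0 , z≤n , z≤n , x≡0
  H15⇒param x (inj₁ (suc j , _ , inj₁ (h , h≤ , x≡))) =
    suc j , h , 0 , 0 , z≤n , h≤ , trans x≡ (in-A j (aₖ k) (aₖ k / 2) h)
    where
      in-A : ∀ j a a/2 h → suc j * a + 2 * h ≡ (suc j + 3 * 0 + 0) * a + 0 * a/2 + 6 * 0 + 3 * 0 + 2 * h
      in-A = solve-∀
  H15⇒param x (inj₁ (suc j , _ , inj₂ (h , h≤ , x≡))) =
    j , h , 0 , 1 , s≤s z≤n , h≤ , trans x≡ (in-B j (aₖ k) (aₖ k / 2) h)
    where
      in-B : ∀ j a a/2 h → suc j * a + a/2 + 3 + 2 * h ≡ (j + 3 * 0 + 1) * a + 1 * a/2 + 6 * 0 + 3 * 1 + 2 * h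
      in-B = solve-∀
  H15⇒param x (inj₂ c≤x) = tail-param x (subst (_≤ x) conductor≡ c≤x)

  generated⇔H15 : ∀ x → Gₖ k x ⇔ H15 k x
  generated⇔H15 x = mk⇔ (λ g → param⇒H15 x (generated⇒param x g))
                        (λ h → param⇒generated x (H15⇒param x h))

-- The windows [i a, (i + 1) a) below the conductor

module Window (k : ℕ) where
  open Generators k
  open Membership k

  ≤12k+7⇒<a : ∀ {y} → y ≤ 12 * k + 7 → y < aₖ k
  ≤12k+7⇒<a {y} y≤ = subst (suc y ≤_) (sym (+-suc (12 * k) 7)) (s≤s y≤)

  2h≤a : ∀ {h} → h ≤ 6 * k + 4 → 2 * h ≤ aₖ k
  2h≤a {h} h≤ = subst (2 * h ≤_) (sym a≡2[a/2]) (*-monoʳ-≤ 2 h≤)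

  0<a : 0 < aₖ k
  0<a = ≤-trans (s≤s z≤n) (m≤n+m 8 (12 * k))

  B-offset≡ : ∀ j h → suc j * aₖ k + aₖ k / 2 + 3 + 2 * h ≡ suc j * aₖ k + (6 * k + 7 + 2 * h)
  B-offset≡ j h = trans (cong (λ z → suc j * aₖ k + z + 3 + 2 * h) a/2≡) (assoc (suc j * aₖ k) k h)
    where
      assoc : ∀ x k h → x + (6 * k + 4) + 3 + 2 * h ≡ x + (6 * k + 7 + 2 * h)
      assoc = solve-∀

  -- Below the conductor, an element at offset y of window i lies in A_i, in B_i,
  -- or in B_(i-1), whose last elements spill over into window i.
  InWindow : ℕ → ℕ → Set
  InWindow i y = (∃[ h ] (y ≡ 2 * h × h ≤ i))
               ⊎ (∃[ h ] (y ≡ 6 * k + 7 + 2 * h × suc h ≤ i))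
               ⊎ (∃[ h ] (y + aₖ k ≡ 6 * k + 7 + 2 * h × 2 + h ≤ i))

  A-inWindow : ∀ {i y} j h → h ≤ suc j → suc j ≤ 6 * k + 4 →
               (i ≡ suc j × y ≡ 2 * h) ⊎ (i ≡ suc (suc j) × y + aₖ k ≡ 2 * h) → InWindow i y
  A-inWindow j h h≤ _  (inj₁ (refl , refl)) = inj₁ (h , refl , h≤)
  A-inWindow {y = y} j h h≤ j< (inj₂ (refl , y+a≡2h)) =
    inj₁ (0 , n≤0⇒n≡0 (+-cancelʳ-≤ (aₖ k) y 0 (≤-trans (≤-reflexive y+a≡2h) (2h≤a (≤-trans h≤ j<))))
         , z≤n)

  B-inWindow : ∀ {i y} j h → h ≤ j →
               (i ≡ suc j × y ≡ 6 * k + 7 + 2 * h)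
               ⊎ (i ≡ suc (suc j) × y + aₖ k ≡ 6 * k + 7 + 2 * h) →
               InWindow i y
  B-inWindow j h h≤ (inj₁ (refl , refl)) = inj₂ (inj₁ (h , refl , s≤s h≤))
  B-inWindow j h h≤ (inj₂ (refl , eq))   = inj₂ (inj₂ (h , eq , s≤s (s≤s h≤)))

  H15-window : ∀ i y → i * aₖ k + y < conductor → y < aₖ k → H15 k (i * aₖ k + y) → InWindow i y
  H15-window i y x<c y<a (inj₂ c≤) = ⊥-elim (<⇒≱ x<c (subst (_≤ i * aₖ k + y) conductor≡ c≤))
  H15-window i y x<c y<a (inj₁ (zero , _ , inj₁ e)) = inj₁ (0 , m+n≡0⇒n≡0 (i * aₖ k) e , z≤n)
  H15-window i y x<c y<a (inj₁ (suc j , j< , inj₁ (h , h≤ , e))) =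
    A-inWindow j h h≤ j<
      (divMod-unique₂ (aₖ k) i y (suc j) (2 * h) y<a
                      (≤-<-trans (2h≤a (≤-trans h≤ j<)) (m<m+n (aₖ k) 0<a)) e)
  H15-window i y x<c y<a (inj₁ (suc j , j< , inj₂ (h , h≤ , e))) =
    B-inWindow j h h≤
      (divMod-unique₂ (aₖ k) i y (suc j) (6 * k + 7 + 2 * h) y<a off<2a (trans e (B-offset≡ j h)))
    where
      off<2a : 6 * k + 7 + 2 * h < aₖ k + aₖ k
      off<2a = +-mono-≤-< {6 * k + 7} (≤-from-+ (6 * k + 1) (6k+7+[6k+1]≡12k+8 k))
                 (subst (2 * h <_) (sym a≡2[a/2]) (*-monoʳ-< 2 (≤-<-trans h≤ j<)))
        where
          6k+7+[6k+1]≡12k+8 : ∀ k → 6 * k + 7 + (6 * k + 1) ≡ 12 * k + 8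
          6k+7+[6k+1]≡12k+8 = solve-∀

  B-odd : ∀ h → 6 * k + 7 + 2 * h ≡ suc (2 * (3 * k + 3 + h))
  B-odd h = 6k+7+2h≡1+2[3k+3+h] k h
    where
      6k+7+2h≡1+2[3k+3+h] : ∀ k h → 6 * k + 7 + 2 * h ≡ suc (2 * (3 * k + 3 + h))
      6k+7+2h≡1+2[3k+3+h] = solve-∀

  even-∈ : ∀ i s → i * aₖ k + 2 * s < conductor → 2 * s < aₖ k → H15 k (i * aₖ k + 2 * s) → s ≤ i
  even-∈ i s x<c y<a x∈ with H15-window i (2 * s) x<c y<a x∈
  ... | inj₁ (h , e , h≤) = subst (_≤ i) (sym (*-cancelˡ-≡ s h 2 e)) h≤
  ... | inj₂ (inj₁ (h , e , _)) = ⊥-elim (even≢odd s (3 * k + 3 + h) (trans e (B-odd h)))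
  ... | inj₂ (inj₂ (h , e , _)) =
    ⊥-elim (even≢odd (s + (6 * k + 4)) (3 * k + 3 + h) (trans (2[s+6k+4]≡2s+a k s) (trans e (B-odd h))))
    where
      2[s+6k+4]≡2s+a : ∀ k s → 2 * (s + (6 * k + 4)) ≡ 2 * s + (12 * k + 8)
      2[s+6k+4]≡2s+a = solve-∀

  odd-∈ : ∀ i s → i * aₖ k + (2 * s + 1) < conductor → 2 * s + 1 < aₖ k →
          H15 k (i * aₖ k + (2 * s + 1)) →
          (3 * k + 3 ≤ s × s ≤ 3 * k + 2 + i) ⊎ (s + 3 * k + 3 ≤ i)
  odd-∈ i s x<c y<a x∈ with H15-window i (2 * s + 1) x<c y<a x∈
  ... | inj₁ (h , e , _) = ⊥-elim (even≢odd h s (trans (sym e) (+-comm (2 * s) 1)))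
  ... | inj₂ (inj₁ (h , e , 1+h≤i)) =
    inj₁ ( subst (3 * k + 3 ≤_) (sym s≡) (m≤m+n _ h)
         , subst (_≤ 3 * k + 2 + i) (trans (3k+2+[1+h]≡3k+3+h k h) (sym s≡)) (+-monoʳ-≤ (3 * k + 2) 1+h≤i))
    where
      s≡ : s ≡ 3 * k + 3 + h
      s≡ = *-cancelˡ-≡ s _ 2 (suc-injective (trans (+-comm 1 (2 * s)) (trans e (B-odd h))))
      3k+2+[1+h]≡3k+3+h : ∀ k h → 3 * k + 2 + suc h ≡ 3 * k + 3 + h
      3k+2+[1+h]≡3k+3+h = solve-∀
  ... | inj₂ (inj₂ (h , e , 2+h≤i)) = inj₂ (subst (_≤ i) (trans (cong (2 +_) h≡) (2+[s+3k+1]≡s+3k+3 k s)) 2+h≤i)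
    where
      2[s+3k+1]+6k+7≡2s+1+a : ∀ k s → 2 * (s + 3 * k + 1) + (6 * k + 7) ≡ 2 * s + 1 + (12 * k + 8)
      2[s+3k+1]+6k+7≡2s+1+a = solve-∀
      2+[s+3k+1]≡s+3k+3 : ∀ k s → 2 + (s + 3 * k + 1) ≡ s + 3 * k + 3
      2+[s+3k+1]≡s+3k+3 = solve-∀
      h≡ : h ≡ s + 3 * k + 1
      h≡ = sym (*-cancelˡ-≡ _ h 2 (+-cancelʳ-≡ (6 * k + 7) _ _
             (trans (2[s+3k+1]+6k+7≡2s+1+a k s) (trans e (+-comm (6 * k + 7) (2 * h))))))

  odd<a : ∀ {s} → s ≤ 3 * k + 2 → 2 * s + 1 < aₖ k
  odd<a s≤ = ≤-<-trans (+-monoˡ-≤ 1 (*-monoʳ-≤ 2 s≤)) (≤-from-+ (6 * k + 2) (2+2[3k+2]+[6k+2]≡a k))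
    where
      2+2[3k+2]+[6k+2]≡a : ∀ k → suc (2 * (3 * k + 2) + 1) + (6 * k + 2) ≡ 12 * k + 8
      2+2[3k+2]+[6k+2]≡a = solve-∀

  even<a : ∀ {t} → t ≤ 3 * k → 2 * (3 * k + 3 + t) < aₖ k
  even<a t≤ = ≤-<-trans (*-monoʳ-≤ 2 (+-monoʳ-≤ (3 * k + 3) t≤)) (≤-from-+ 1 (2+2[6k+3]≡a k))
    where
      2+2[6k+3]≡a : ∀ k → suc (2 * (3 * k + 3 + 3 * k)) + 1 ≡ 12 * k + 8
      2+2[6k+3]≡a = solve-∀

  even-∉ : ∀ i s → i * aₖ k + 2 * s < conductor → 2 * s < aₖ k → i < s → ¬ H15 k (i * aₖ k + 2 * s)
  even-∉ i s x<c y<a i<s x∈ = <⇒≱ i<s (even-∈ i s x<c y<a x∈)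

  odd-∉-middle : ∀ i s → i * aₖ k + (2 * s + 1) < conductor → i ≤ s + 3 * k + 2 → s ≤ 3 * k + 2 →
                 ¬ H15 k (i * aₖ k + (2 * s + 1))
  odd-∉-middle i s x<c i≤ s≤ x∈ =
    [ (λ (3k+3≤s , _) → n+3≰n+2 (3 * k) 3k+3≤s s≤)
    , (λ s+3k+3≤i → n+3≰n+2 (s + 3 * k) s+3k+3≤i i≤) ]′
      (odd-∈ i s x<c (odd<a s≤) x∈)

  odd-∉-above : ∀ i s → i * aₖ k + (2 * s + 1) < conductor → 2 * s + 1 < aₖ k → 3 * k + 2 + i < s →
                ¬ H15 k (i * aₖ k + (2 * s + 1))
  odd-∉-above i s x<c y<a s> x∈ =
    [ (λ (_ , s≤) → <⇒≱ s> s≤)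
    , (λ s+3k+3≤i → <⇒≱ s> (≤-trans (m≤m+n s (3 * k)) (≤-trans (m≤m+n (s + 3 * k) 3)
                                 (≤-trans s+3k+3≤i (m≤n+m i (3 * k + 2)))))) ]′
      (odd-∈ i s x<c y<a x∈)

  low⇒<6k+4 : ∀ {i} → i ≤ 3 * k + 2 → i < 6 * k + 4
  low⇒<6k+4 i≤ = ≤-trans (s≤s i≤) (≤-from-+ (3 * k + 1) (1+[3k+2]+[3k+1]≡6k+4 k))
    where
      1+[3k+2]+[3k+1]≡6k+4 : ∀ k → suc (3 * k + 2) + (3 * k + 1) ≡ 6 * k + 4
      1+[3k+2]+[3k+1]≡6k+4 = solve-∀

  gap-after-A-∉ : ∀ i y → i ≤ 3 * k + 2 → 2 * i < y → y ≤ 6 * k + 6 → ¬ H15 k (i * aₖ k + y)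
  gap-after-A-∉ i y i≤ 2i<y y≤ = [ even , odd ]′ (even-or-odd y)
    where
      y<a : y < aₖ k
      y<a = ≤-<-trans y≤ (≤-from-+ (6 * k + 1) (1+[6k+6]+[6k+1]≡a k))
        where
          1+[6k+6]+[6k+1]≡a : ∀ k → suc (6 * k + 6) + (6 * k + 1) ≡ 12 * k + 8
          1+[6k+6]+[6k+1]≡a = solve-∀
      x<c : i * aₖ k + y < conductor
      x<c = window-<-conductor i y (low⇒<6k+4 i≤) y<a
      even : ∃[ s ] (y ≡ 2 * s) → ¬ H15 k (i * aₖ k + y)
      even (s , refl) = even-∉ i s x<c y<a (*-cancelˡ-< 2 i s 2i<y)
      odd : ∃[ s ] (y ≡ 2 * s + 1) → ¬ H15 k (i * aₖ k + y)
      odd (s , refl) = odd-∉-middle i s x<c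
        (≤-trans i≤ (≤-trans (m≤n+m (3 * k + 2) s) (≤-reflexive (sym (+-assoc s (3 * k) 2)))))
        (≤-pred (subst (suc s ≤_) (+-suc (3 * k) 2) (*-cancelˡ-< 2 s (3 * k + 3) 2s<)))
        where
          6k+6≡2[3k+3] : ∀ k → 6 * k + 6 ≡ 2 * (3 * k + 3)
          6k+6≡2[3k+3] = solve-∀
          2s< : 2 * s < 2 * (3 * k + 3)
          2s< = subst₂ _≤_ (+-comm (2 * s) 1) (6k+6≡2[3k+3] k) y≤

  gap-after-B-∉ : ∀ i y → i ≤ 3 * k + 1 → 6 * k + 5 + 2 * i < y → y < aₖ k → ¬ H15 k (i * aₖ k + y)
  gap-after-B-∉ i y i≤ y> y<a = [ even , odd ]′ (even-or-odd y)
    where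
      x<c : i * aₖ k + y < conductor
      x<c = window-<-conductor i y (low⇒<6k+4 (≤-trans i≤ (+-monoʳ-≤ (3 * k) (s≤s z≤n)))) y<a
      even : ∃[ s ] (y ≡ 2 * s) → ¬ H15 k (i * aₖ k + y)
      even (s , refl) = even-∉ i s x<c y<a (*-cancelˡ-< 2 i s (≤-<-trans (m≤n+m (2 * i) (6 * k + 5)) y>))
      odd : ∃[ s ] (y ≡ 2 * s + 1) → ¬ H15 k (i * aₖ k + y)
      odd (s , refl) =
        odd-∉-above i s x<c y<a
          (*-cancelˡ-< 2 _ s (s≤s⁻¹ (subst₂ _≤_ (cong suc (6k+5+2i≡1+2[3k+2+i] k i)) (+-comm (2 * s) 1) y>)))
        where
          6k+5+2i≡1+2[3k+2+i] : ∀ k i → 6 * k + 5 + 2 * i ≡ suc (2 * (3 * k + 2 + i))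
          6k+5+2i≡1+2[3k+2+i] = solve-∀

  window₀-∉ : ∀ y → 0 < y → y < aₖ k → ¬ H15 k y
  window₀-∉ (suc t) _ y<a with suc t ≤? 6 * k + 6
  ... | yes y≤ = gap-after-A-∉ 0 (suc t) z≤n (s≤s z≤n) y≤
  ... | no  y≰ = gap-after-B-∉ 0 (suc t) z≤n
                   (subst (_< suc t) (sym (+-identityʳ (6 * k + 5)))
                          (≤-trans (n≤1+n _) (subst (_< suc t) (+-suc (6 * k) 5) (≰⇒> y≰))))
                   y<a

-- Scanning H₁₅ window by window

module Walk (k : ℕ) where
  open Generators k
  open Membership k
  open Window k
  open Enumeration H15? (inj₁ (0 , z≤n , inj₁ refl)) conductor (λ _ → ∈-tail) public

  κ : ℤ₃
  κ = res₃ k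

  a-e : Expr
  a-e = lit 12 :* kv :+ lit 8

  low-end : ℕ → ℕ
  low-end j = j * aₖ k + (12 * k + 7)

  low-end-e start-e A-end-e B-start-e : Expr
  low-end-e = jv :* a-e :+ (lit 12 :* kv :+ lit 7)
  start-e   = lit 1 :+ low-end-e
  A-end-e   = start-e :+ lit 2 :* (lit 1 :+ jv)
  B-start-e = (lit 1 :+ jv) :* a-e :+ (lit 6 :* kv :+ lit 5)

  -- In window i = j + 1 ≤ 3k + 2 the scan meets i a ∈ A_i, then the rest of A_i
  -- alternating with gaps, a gap, the first m₃ elements of B_i alternating with
  -- gaps, and a final gap.
  low-window : ∀ j ι m₃ d₂ d₄ {S s₁ s₃} → res₃ j ≡ ι →
    suc j ≤ 3 * k + 2 → m₃ ≤ suc j → m₃ ≤ 3 * k + 1 →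
    2 * suc j + d₂ ≡ 6 * k + 5 → 6 * k + 5 + 2 * m₃ + d₄ ≡ 12 * k + 7 →
    (∀ t → t < d₄ → ¬ H15 k (suc (suc j * aₖ k + (6 * k + 5) + 2 * m₃ + t))) →
    Fresh (⟦ start-e ⟧₃ ι κ) S →
    push (⟦ start-e ⟧₃ ι κ) S ≡ run 2₃ (⟦ start-e ⟧₃ ι κ) s₁ →
    run 2₃ (⟦ A-end-e ⟧₃ ι κ) (suc₃ ι +₃ s₁)
      ≡ run 2₃ (⟦ B-start-e ⟧₃ ι κ) s₃ →
    Reach (low-end j) S →
    Reach (low-end (suc j)) (run 2₃ (res₃ (suc j * aₖ k + (6 * k + 5) + 2 * m₃)) (res₃ m₃ +₃ s₃))
  low-window j ι m₃ d₂ d₄ {S} {s₁} {s₃} hj i≤ m₃≤i m₃≤ ed₂ ed₄ after-B fresh₀ push₀ jump reach₀ =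
    subst (λ y → Reach y (run 2₃ (res₃ x₄) (res₃ m₃ +₃ s₃))) x₄+d₄≡ (reach-gap x₄ d₄ after-B reach₄)
    where
      i = suc j
      x₁ = suc (low-end j)
      x₂ = x₁ + 2 * i
      x₃ = i * aₖ k + (6 * k + 5)
      x₄ = x₃ + 2 * m₃
      ρ₁ : res₃ x₁ ≡ ⟦ start-e ⟧₃ ι κ
      ρ₁ = res₃-⟦⟧ start-e j k hj
      ρ₂ : res₃ x₂ ≡ ⟦ A-end-e ⟧₃ ι κ
      ρ₂ = res₃-⟦⟧ A-end-e j k hj
      ρ₃ : res₃ x₃ ≡ ⟦ B-start-e ⟧₃ ι κ
      ρ₃ = res₃-⟦⟧ B-start-e j k hj

      x₁≡ : ∀ k j → suc (j * (12 * k + 8) + (12 * k + 7)) ≡ suc j * (12 * k + 8) + 2 * 0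
      x₁≡ = solve-∀
      odd≡ : ∀ k j t → suc (suc (j * (12 * k + 8) + (12 * k + 7)) + 2 * t)
                       ≡ suc j * (12 * k + 8) + (2 * t + 1)
      odd≡ = solve-∀
      even≡ : ∀ k j t → 2 + (suc (j * (12 * k + 8) + (12 * k + 7)) + 2 * t) ≡ suc j * (12 * k + 8) + 2 * suc t
      even≡ = solve-∀
      gap≡ : ∀ k j t → suc (suc (j * (12 * k + 8) + (12 * k + 7)) + 2 * suc j + t)
                       ≡ suc j * (12 * k + 8) + (2 * suc j + suc t)
      gap≡ = solve-∀
      x₂+d≡ : ∀ k j d → suc (j * (12 * k + 8) + (12 * k + 7)) + 2 * suc j + d
                        ≡ suc j * (12 * k + 8) + (2 * suc j + d)
      x₂+d≡ = solve-∀
      even₂≡ : ∀ k x t → suc (x + (6 * k + 5) + 2 * t) ≡ x + 2 * (3 * k + 3 + t)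
      even₂≡ = solve-∀
      B≡ : ∀ k x t → 2 + (x + (6 * k + 5) + 2 * t) ≡ x + (6 * k + 4) + 3 + 2 * t
      B≡ = solve-∀
      assoc : ∀ x y z w → x + y + z + w ≡ x + (y + z + w)
      assoc = solve-∀

      reach₁ : Reach x₁ (run 2₃ (res₃ x₁) s₁)
      reach₁ = subst (Reach x₁)
                 (trans (cong (λ ρ → push ρ S) ρ₁) (trans push₀ (cong (λ ρ → run 2₃ ρ s₁) (sym ρ₁))))
                 (reach-push (subst (H15 k) (sym (x₁≡ k j)) (∈A i 0 z≤n))
                             (subst (λ ρ → Fresh ρ S) (sym ρ₁) fresh₀) reach₀)

      odd∉ : ∀ t → t < i → ¬ H15 k (suc (x₁ + 2 * t))
      odd∉ t t<i x∈ =
        odd-∉-middle i t (window-<-conductor i _ (low⇒<6k+4 i≤) (odd<a (≤-trans (<⇒≤ t<i) i≤)))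
        (≤-trans i≤ (≤-trans (m≤n+m (3 * k + 2) t) (≤-reflexive (sym (+-assoc t (3 * k) 2)))))
        (≤-trans (<⇒≤ t<i) i≤) (subst (H15 k) (odd≡ k j t) x∈)

      reach₂ : Reach x₂ (run 2₃ (res₃ x₂) (res₃ i +₃ s₁))
      reach₂ = reach-run₂ x₁ i s₁ odd∉ (λ t t<i → subst (H15 k) (sym (even≡ k j t)) (∈A i (suc t) t<i))
                          reach₁

      gap∉ : ∀ t → t < d₂ → ¬ H15 k (suc (x₂ + t))
      gap∉ t t<d x∈ = gap-after-A-∉ i (2 * i + suc t) i≤ (m<m+n (2 * i) z<s)
        (≤-trans (+-monoʳ-≤ (2 * i) t<d) (≤-trans (≤-reflexive ed₂) (+-monoʳ-≤ (6 * k) (n≤1+n 5))))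
        (subst (H15 k) (gap≡ k j t) x∈)

      reach₃ : Reach x₃ (run 2₃ (res₃ x₃) s₃)
      reach₃ = subst₂ Reach (trans (x₂+d≡ k j d₂) (cong (i * aₖ k +_) ed₂))
                 (trans (cong₂ (λ ρ σ → run 2₃ ρ (σ +₃ s₁)) ρ₂ (cong suc₃ hj))
                        (trans jump (cong (λ ρ → run 2₃ ρ s₃) (sym ρ₃))))
                 (reach-gap x₂ d₂ gap∉ reach₂)

      even∉ : ∀ t → t < m₃ → ¬ H15 k (suc (x₃ + 2 * t))
      even∉ t t<m x∈ = even-∉ i (3 * k + 3 + t) (window-<-conductor i _ (low⇒<6k+4 i≤) y<a) y<a
                         (≤-trans (s≤s i≤) (≤-trans (≤-reflexive (sym (+-suc (3 * k) 2))) (m≤m+n _ t)))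
                         (subst (H15 k) (even₂≡ k (i * aₖ k) t) x∈)
        where
          y<a = even<a (s≤s⁻¹ (≤-trans t<m (subst (m₃ ≤_) (+-comm (3 * k) 1) m₃≤)))

      reach₄ : Reach x₄ (run 2₃ (res₃ x₄) (res₃ m₃ +₃ s₃))
      reach₄ = reach-run₂ x₃ m₃ s₃ even∉
                 (λ t t<m → subst (H15 k) (sym (B≡ k (i * aₖ k) t)) (∈B j t (s≤s⁻¹ (≤-trans t<m m₃≤i))))
                 reach₃

      x₄+d₄≡ : x₄ + d₄ ≡ low-end i
      x₄+d₄≡ = trans (assoc (i * aₖ k) (6 * k + 5) (2 * m₃) d₄) (cong (i * aₖ k +_) ed₄)

  low-block : ℤ₃ → Block
  low-block 0₃ = lacks 0₃
  low-block 1₃ = empty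
  low-block 2₃ = empty

  LowInv : ℕ → Set
  LowInv j = Reach (low-end j) (low-block (res₃ (suc j)))

  low-base : LowInv 0
  low-base = reach-gap 0 (12 * k + 7)
    (λ t t< → window₀-∉ (suc t) (s≤s z≤n) (≤12k+7⇒<a t<))
    ((λ _ ()) , refl)

  low-step : ∀ j e → suc j + e ≡ 3 * k + 1 → LowInv j → LowInv (suc j)
  low-step j e je inv = by-residue (res₃ j) refl
    where
      i = suc j
      i≤ : i ≤ 3 * k + 1
      i≤ = ≤-from-+ e je
      d₂≡ : 2 * i + (2 * e + 3) ≡ 6 * k + 5
      d₂≡ = trans (2i+[2e+3]≡2[i+e]+3 i e) (trans (cong (λ n → 2 * n + 3) je) (2[3k+1]+3≡6k+5 k))
        where
          2i+[2e+3]≡2[i+e]+3 : ∀ i e → 2 * i + (2 * e + 3) ≡ 2 * (i + e) + 3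
          2i+[2e+3]≡2[i+e]+3 = solve-∀
          2[3k+1]+3≡6k+5 : ∀ k → 2 * (3 * k + 1) + 3 ≡ 6 * k + 5
          2[3k+1]+3≡6k+5 = solve-∀
      d₄≡ : 6 * k + 5 + 2 * i + 2 * e ≡ 12 * k + 7
      d₄≡ = trans (6k+5+2i+2e≡6k+5+2[i+e] k i e) (trans (cong (λ n → 6 * k + 5 + 2 * n) je) (6k+5+2[3k+1]≡12k+7 k))
        where
          6k+5+2i+2e≡6k+5+2[i+e] : ∀ k i e → 6 * k + 5 + 2 * i + 2 * e ≡ 6 * k + 5 + 2 * (i + e)
          6k+5+2i+2e≡6k+5+2[i+e] = solve-∀
          6k+5+2[3k+1]≡12k+7 : ∀ k → 6 * k + 5 + 2 * (3 * k + 1) ≡ 12 * k + 7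
          6k+5+2[3k+1]≡12k+7 = solve-∀
      after-B : ∀ t → t < 2 * e → ¬ H15 k (suc (i * aₖ k + (6 * k + 5) + 2 * i + t))
      after-B t t< x∈ = gap-after-B-∉ i (6 * k + 5 + 2 * i + suc t) i≤ (m<m+n _ z<s)
        (≤12k+7⇒<a (subst (_≤ 12 * k + 7) (sym (+-suc (6 * k + 5 + 2 * i) t))
                                      (subst (6 * k + 5 + 2 * i + t <_) d₄≡ (+-monoʳ-< (6 * k + 5 + 2 * i) t<))))
        (subst (H15 k) (1+[x+y+t]≡x+[y+[1+t]] (i * aₖ k) k i t) x∈)
        where
          1+[x+y+t]≡x+[y+[1+t]] : ∀ x k i t → suc (x + (6 * k + 5) + 2 * i + t) ≡ x + (6 * k + 5 + 2 * i + suc t)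
          1+[x+y+t]≡x+[y+[1+t]] = solve-∀
      end-e : Expr
      end-e = (lit 1 :+ jv) :* a-e :+ (lit 6 :* kv :+ lit 5) :+ lit 2 :* (lit 1 :+ jv)
      window : ∀ ι {S s₁ s₃} → res₃ j ≡ ι → low-block (suc₃ ι) ≡ S →
        Fresh (⟦ start-e ⟧₃ ι κ) S → push (⟦ start-e ⟧₃ ι κ) S ≡ run 2₃ (⟦ start-e ⟧₃ ι κ) s₁ →
        run 2₃ (⟦ A-end-e ⟧₃ ι κ) (suc₃ ι +₃ s₁) ≡ run 2₃ (⟦ B-start-e ⟧₃ ι κ) s₃ →
        run 2₃ (⟦ end-e ⟧₃ ι κ) (suc₃ ι +₃ s₃) ≡ low-block (suc₃ (suc₃ ι)) →
        LowInv i
      window ι {s₃ = s₃} hj S≡ fresh₀ push₀ jump end =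
        subst (Reach (low-end i))
          (trans (cong₂ (λ ρ σ → run 2₃ ρ (σ +₃ s₃)) (res₃-⟦⟧ end-e j k hj) (cong suc₃ hj))
                 (trans end (cong (λ σ → low-block (suc₃ (suc₃ σ))) (sym hj))))
          (low-window j ι i (2 * e + 3) (2 * e) hj (≤-trans i≤ (+-monoʳ-≤ (3 * k) (n≤1+n 1))) ≤-refl i≤
             d₂≡ d₄≡ after-B fresh₀ push₀ jump
             (subst (Reach (low-end j)) (trans (cong (λ σ → low-block (suc₃ σ)) hj) S≡) inv))
      by-residue : ∀ ι → res₃ j ≡ ι → LowInv i
      by-residue 0₃ hj = window 0₃ {empty}    {1₃} {2₃} hj refl tt   refl refl refl
      by-residue 1₃ hj = window 1₃ {empty}    {1₃} {0₃} hj refl tt   refl refl refl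
      by-residue 2₃ hj = window 2₃ {lacks 0₃} {0₃} {0₃} hj refl refl refl refl refl

  low-all : ∀ j → j ≤ 3 * k + 1 → LowInv j
  low-all zero    _  = low-base
  low-all (suc j) j< =
    let e , je = m≤n⇒∃[o]m+o≡n j< in low-step j e je (low-all j (≤-trans (n≤1+n j) j<))

  high-end : ℕ → ℕ
  high-end t = low-end (3 * k + 2 + t)

  high-end-e dense₁-end-e : Expr
  high-end-e   = (lit 3 :* kv :+ lit 2 :+ jv) :* a-e :+ (lit 12 :* kv :+ lit 7)
  dense₁-end-e = high-end-e :+ (lit 2 :* jv :+ lit 3)

  high-mid : ℕ → ℕ
  high-mid t = (3 * k + 3 + t) * aₖ k + (6 * k + 6)

  high-mid-e dense₂-end-e : Expr
  high-mid-e   = (lit 3 :* kv :+ lit 3 :+ jv) :* a-e :+ (lit 6 :* kv :+ lit 6)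
  dense₂-end-e = high-mid-e :+ (lit 2 :* jv :+ lit 1)

  -- In window i = 3k + 3 + t the offsets 0 … 2t + 2 all lie in A_i or in the
  -- overflow of B_(i-1); after them A_i continues, alternating with gaps, up to 6k + 6.
  high-window₁ : ∀ t ι m {S sa sb} → res₃ t ≡ ι → t ≤ 3 * k + 1 → t + m ≡ 3 * k + 2 →
    S ≡ run 1₃ (⟦ high-end-e ⟧₃ ι κ) sa →
    run 1₃ (⟦ dense₁-end-e ⟧₃ ι κ) (⟦ lit 2 :* jv :+ lit 3 ⟧₃ ι κ +₃ sa)
      ≡ run 2₃ (⟦ dense₁-end-e ⟧₃ ι κ) sb →
    Reach (high-end t) S → Reach (high-mid t) (run 2₃ (res₃ (high-mid t)) (res₃ m +₃ sb))
  high-window₁ t ι m {S} {sa} {sb} ht t≤ tm S≡ turn reach₀ =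
    subst (λ y → Reach y (run 2₃ (res₃ y) (res₃ m +₃ sb))) xc≡ reach-c
    where
      i = 3 * k + 3 + t
      xb = high-end t + (2 * t + 3)
      ρ₀ : res₃ (high-end t) ≡ ⟦ high-end-e ⟧₃ ι κ
      ρ₀ = res₃-⟦⟧ high-end-e t k ht
      ρb : res₃ xb ≡ ⟦ dense₁-end-e ⟧₃ ι κ
      ρb = res₃-⟦⟧ dense₁-end-e t k ht
      ρd : res₃ (2 * t + 3) ≡ ⟦ lit 2 :* jv :+ lit 3 ⟧₃ ι κ
      ρd = res₃-⟦⟧ (lit 2 :* jv :+ lit 3) t k ht

      pos≡ : ∀ k t t′ → suc ((3 * k + 2 + t) * (12 * k + 8) + (12 * k + 7) + t′)
                        ≡ (3 * k + 3 + t) * (12 * k + 8) + t′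
      pos≡ = solve-∀
      spill≡ : ∀ k t s → (3 * k + 3 + t) * (12 * k + 8) + (2 * s + 1)
                         ≡ suc (3 * k + 1 + t) * (12 * k + 8) + (6 * k + 4) + 3 + 2 * (s + 3 * k + 1)
      spill≡ = solve-∀
      2t+3≡ : ∀ t → 2 * t + 3 ≡ 2 * suc t + 1
      2t+3≡ = solve-∀
      1+t≤i : ∀ k t → suc t ≤ 3 * k + 3 + t
      1+t≤i k t = ≤-from-+ (3 * k + 2) (1+t+[3k+2]≡3k+3+t k t)
        where
          1+t+[3k+2]≡3k+3+t : ∀ k t → suc t + (3 * k + 2) ≡ 3 * k + 3 + t
          1+t+[3k+2]≡3k+3+t = solve-∀

      full : ∀ t′ → t′ < 2 * t + 3 → H15 k (suc (high-end t + t′))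
      full t′ t′< = subst (H15 k) (sym (pos≡ k t t′)) ([ even , odd ]′ (even-or-odd t′))
        where
          t′<′ : t′ < 2 * suc t + 1
          t′<′ = subst (t′ <_) (2t+3≡ t) t′<
          even : ∃[ s ] (t′ ≡ 2 * s) → H15 k (i * aₖ k + t′)
          even (s , refl) = ∈A i s (≤-trans (2s<2n+1⇒s≤n s (suc t) t′<′) (1+t≤i k t))
          odd : ∃[ s ] (t′ ≡ 2 * s + 1) → H15 k (i * aₖ k + t′)
          odd (s , refl) = subst (H15 k) (sym (spill≡ k t s)) (∈B (3 * k + 1 + t) (s + 3 * k + 1)
            (subst (_≤ 3 * k + 1 + t) (+-comm (3 * k + 1) s ∙ sym (+-assoc s (3 * k) 1))
              (+-monoʳ-≤ (3 * k + 1) (s≤s⁻¹ (2s+1<2n+1⇒s<n s (suc t) t′<′)))))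
            where _∙_ = trans

      reach-b : Reach xb (run 2₃ (res₃ xb) sb)
      reach-b = subst (Reach xb)
        (trans (cong₂ (λ ρ σ → run 1₃ ρ (σ +₃ sa)) ρb ρd) (trans turn (cong (λ ρ → run 2₃ ρ sb) (sym ρb))))
        (reach-run₁ (high-end t) (2 * t + 3) sa full
          (subst (Reach (high-end t)) (trans S≡ (cong (λ ρ → run 1₃ ρ sa) (sym ρ₀))) reach₀))

      odd≡ : ∀ k t t′ → suc ((3 * k + 2 + t) * (12 * k + 8) + (12 * k + 7) + (2 * t + 3) + 2 * t′)
                        ≡ (3 * k + 3 + t) * (12 * k + 8) + (2 * (t + 1 + t′) + 1)
      odd≡ = solve-∀
      even≡ : ∀ k t t′ → 2 + ((3 * k + 2 + t) * (12 * k + 8) + (12 * k + 7) + (2 * t + 3) + 2 * t′)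
                         ≡ (3 * k + 3 + t) * (12 * k + 8) + 2 * suc (t + 1 + t′)
      even≡ = solve-∀
      s≤3k+2 : ∀ t′ → t′ < m → t + 1 + t′ ≤ 3 * k + 2
      s≤3k+2 t′ t′<m = subst₂ _≤_ (t+[1+t′]≡t+1+t′ t t′) tm (+-monoʳ-≤ t t′<m)
        where
          t+[1+t′]≡t+1+t′ : ∀ t t′ → t + suc t′ ≡ t + 1 + t′
          t+[1+t′]≡t+1+t′ = solve-∀

      odd∉ : ∀ t′ → t′ < m → ¬ H15 k (suc (xb + 2 * t′))
      odd∉ t′ t′<m x∈ = odd-∉-middle i (t + 1 + t′)
        (below-conductor i _ i≤6k+4
          (≤-trans (+-monoˡ-≤ 1 (*-monoʳ-≤ 2 (s≤3k+2 t′ t′<m))) (≤-from-+ 1 (2[3k+2]+2≡6k+6 k))))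
        (≤-from-+ t′ (3k+3+t+t′≡t+1+t′+3k+2 k t t′)) (s≤3k+2 t′ t′<m) (subst (H15 k) (odd≡ k t t′) x∈)
        where
          i≤6k+4 : i ≤ 6 * k + 4
          i≤6k+4 = subst (i ≤_) (3k+3+[3k+1]≡6k+4 k) (+-monoʳ-≤ (3 * k + 3) t≤)
            where
              3k+3+[3k+1]≡6k+4 : ∀ k → 3 * k + 3 + (3 * k + 1) ≡ 6 * k + 4
              3k+3+[3k+1]≡6k+4 = solve-∀
          2[3k+2]+2≡6k+6 : ∀ k → 2 * (3 * k + 2) + 1 + 1 ≡ 6 * k + 6
          2[3k+2]+2≡6k+6 = solve-∀
          3k+3+t+t′≡t+1+t′+3k+2 : ∀ k t t′ → 3 * k + 3 + t + t′ ≡ t + 1 + t′ + 3 * k + 2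
          3k+3+t+t′≡t+1+t′+3k+2 = solve-∀

      even∈ : ∀ t′ → t′ < m → H15 k (2 + (xb + 2 * t′))
      even∈ t′ t′<m = subst (H15 k) (sym (even≡ k t t′))
        (∈A i (suc (t + 1 + t′))
          (≤-trans (s≤s (s≤3k+2 t′ t′<m)) (≤-trans (≤-reflexive (sym (+-suc (3 * k) 2))) (m≤m+n _ t))))

      reach-c : Reach (xb + 2 * m) (run 2₃ (res₃ (xb + 2 * m)) (res₃ m +₃ sb))
      reach-c = reach-run₂ xb m sb odd∉ even∈ reach-b

      xc≡ : xb + 2 * m ≡ high-mid t
      xc≡ = trans (dense₁-end+2m≡ k t m) (trans (cong (λ n → (3 * k + 3 + t) * aₖ k + 2 * n + 2) tm) (2[3k+2]+2≡6k+6′ k t))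
        where
          dense₁-end+2m≡ : ∀ k t m → (3 * k + 2 + t) * (12 * k + 8) + (12 * k + 7) + (2 * t + 3) + 2 * m
                             ≡ (3 * k + 3 + t) * (12 * k + 8) + 2 * (t + m) + 2
          dense₁-end+2m≡ = solve-∀
          2[3k+2]+2≡6k+6′ : ∀ k t → (3 * k + 3 + t) * (12 * k + 8) + 2 * (3 * k + 2) + 2
                           ≡ (3 * k + 3 + t) * (12 * k + 8) + (6 * k + 6)
          2[3k+2]+2≡6k+6′ = solve-∀

  -- After offset 6k + 6 of window i = 3k + 3 + t come 2t + 1 consecutive elements of
  -- B_i and A_i, then B_i alternating with gaps up to the end of the window.
  high-window₂ : ∀ t ι e {sc sd} → res₃ t ≡ ι → t + e ≡ 3 * k →
    run 1₃ (⟦ dense₂-end-e ⟧₃ ι κ) (⟦ lit 2 :* jv :+ lit 1 ⟧₃ ι κ +₃ sc)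
      ≡ run 2₃ (⟦ dense₂-end-e ⟧₃ ι κ) sd →
    Reach (high-mid t) (run 1₃ (res₃ (high-mid t)) sc) →
    Reach (high-end (suc t)) (run 2₃ (res₃ (high-end (suc t))) (res₃ e +₃ sd))
  high-window₂ t ι e {sc} {sd} ht te turn reach₀ =
    subst (λ y → Reach y (run 2₃ (res₃ y) (res₃ e +₃ sd))) end≡ reach-e
    where
      i = 3 * k + 3 + t
      xd = high-mid t + (2 * t + 1)
      ρd : res₃ xd ≡ ⟦ dense₂-end-e ⟧₃ ι κ
      ρd = res₃-⟦⟧ dense₂-end-e t k ht
      ρ′ : res₃ (2 * t + 1) ≡ ⟦ lit 2 :* jv :+ lit 1 ⟧₃ ι κ
      ρ′ = res₃-⟦⟧ (lit 2 :* jv :+ lit 1) t k ht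
      t≤3k : t ≤ 3 * k
      t≤3k = ≤-from-+ e te

      pos≡ : ∀ k t t′ → suc ((3 * k + 3 + t) * (12 * k + 8) + (6 * k + 6) + t′)
                        ≡ (3 * k + 3 + t) * (12 * k + 8) + (6 * k + 7 + t′)
      pos≡ = solve-∀
      B≡ : ∀ k t s → (3 * k + 3 + t) * (12 * k + 8) + (6 * k + 7 + 2 * s)
                     ≡ suc (3 * k + 2 + t) * (12 * k + 8) + (6 * k + 4) + 3 + 2 * s
      B≡ = solve-∀
      A≡ : ∀ k t s → (3 * k + 3 + t) * (12 * k + 8) + (6 * k + 7 + (2 * s + 1))
                     ≡ (3 * k + 3 + t) * (12 * k + 8) + 2 * (3 * k + 4 + s)
      A≡ = solve-∀

      full : ∀ t′ → t′ < 2 * t + 1 → H15 k (suc (high-mid t + t′))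
      full t′ t′< = subst (H15 k) (sym (pos≡ k t t′)) ([ even , odd ]′ (even-or-odd t′))
        where
          even : ∃[ s ] (t′ ≡ 2 * s) → H15 k (i * aₖ k + (6 * k + 7 + t′))
          even (s , refl) = subst (H15 k) (sym (B≡ k t s))
            (∈B (3 * k + 2 + t) s (≤-trans (2s<2n+1⇒s≤n s t t′<) (m≤n+m t (3 * k + 2))))
          odd : ∃[ s ] (t′ ≡ 2 * s + 1) → H15 k (i * aₖ k + (6 * k + 7 + t′))
          odd (s , refl) = subst (H15 k) (sym (A≡ k t s))
            (∈A i (3 * k + 4 + s) (subst (_≤ i) (3k+3+[1+s]≡3k+4+s k s) (+-monoʳ-≤ (3 * k + 3) (2s+1<2n+1⇒s<n s t t′<))))
            where
              3k+3+[1+s]≡3k+4+s : ∀ k s → 3 * k + 3 + suc s ≡ 3 * k + 4 + s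
              3k+3+[1+s]≡3k+4+s = solve-∀

      reach-d : Reach xd (run 2₃ (res₃ xd) sd)
      reach-d = subst (Reach xd)
        (trans (cong₂ (λ ρ σ → run 1₃ ρ (σ +₃ sc)) ρd ρ′) (trans turn (cong (λ ρ → run 2₃ ρ sd) (sym ρd))))
        (reach-run₁ (high-mid t) (2 * t + 1) sc full reach₀)

      even≡ : ∀ k t t′ → suc ((3 * k + 3 + t) * (12 * k + 8) + (6 * k + 6) + (2 * t + 1) + 2 * t′)
                         ≡ (3 * k + 3 + t) * (12 * k + 8) + 2 * (3 * k + 3 + (t + 1 + t′))
      even≡ = solve-∀
      odd≡ : ∀ k t t′ → 2 + ((3 * k + 3 + t) * (12 * k + 8) + (6 * k + 6) + (2 * t + 1) + 2 * t′)
                        ≡ suc (3 * k + 2 + t) * (12 * k + 8) + (6 * k + 4) + 3 + 2 * (t + 1 + t′)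
      odd≡ = solve-∀
      s≤3k : ∀ t′ → t′ < e → t + 1 + t′ ≤ 3 * k
      s≤3k t′ t′<e = subst₂ _≤_ (t+[1+t′]≡t+1+t′ t t′) te (+-monoʳ-≤ t t′<e)
        where
          t+[1+t′]≡t+1+t′ : ∀ t t′ → t + suc t′ ≡ t + 1 + t′
          t+[1+t′]≡t+1+t′ = solve-∀

      even∉ : ∀ t′ → t′ < e → ¬ H15 k (suc (xd + 2 * t′))
      even∉ t′ t′<e x∈ =
        even-∉ i (3 * k + 3 + (t + 1 + t′)) (window-<-conductor i _ i<6k+4 y<a) y<a
          (+-monoʳ-< (3 * k + 3) (≤-trans (≤-reflexive (+-comm 1 t)) (m≤m+n (t + 1) t′)))
          (subst (H15 k) (even≡ k t t′) x∈)
        where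
          y<a = even<a (s≤3k t′ t′<e)
          i<6k+4 : i < 6 * k + 4
          i<6k+4 = subst (suc i ≤_) (1+[3k+3+3k]≡6k+4 k) (s≤s (+-monoʳ-≤ (3 * k + 3) t≤3k))
            where
              1+[3k+3+3k]≡6k+4 : ∀ k → suc (3 * k + 3 + 3 * k) ≡ 6 * k + 4
              1+[3k+3+3k]≡6k+4 = solve-∀

      B∈ : ∀ t′ → t′ < e → H15 k (2 + (xd + 2 * t′))
      B∈ t′ t′<e = subst (H15 k) (sym (odd≡ k t t′))
        (∈B (3 * k + 2 + t) (t + 1 + t′)
          (≤-trans (s≤3k t′ t′<e) (≤-trans (m≤m+n (3 * k) 2) (m≤m+n (3 * k + 2) t))))

      reach-e : Reach (xd + 2 * e) (run 2₃ (res₃ (xd + 2 * e)) (res₃ e +₃ sd))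
      reach-e = reach-run₂ xd e sd even∉ B∈ reach-d

      end≡ : xd + 2 * e ≡ high-end (suc t)
      end≡ = trans (dense₂-end+2e≡ k t e)
                   (trans (cong (λ n → (3 * k + 2 + suc t) * aₖ k + (6 * k + 7) + 2 * n) te) (6k+7+2[3k]≡12k+7 k t))
        where
          dense₂-end+2e≡ : ∀ k t e → (3 * k + 3 + t) * (12 * k + 8) + (6 * k + 6) + (2 * t + 1) + 2 * e
                             ≡ (3 * k + 2 + suc t) * (12 * k + 8) + (6 * k + 7) + 2 * (t + e)
          dense₂-end+2e≡ = solve-∀
          6k+7+2[3k]≡12k+7 : ∀ k t → (3 * k + 2 + suc t) * (12 * k + 8) + (6 * k + 7) + 2 * (3 * k)
                           ≡ (3 * k + 2 + suc t) * (12 * k + 8) + (12 * k + 7)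
          6k+7+2[3k]≡12k+7 = solve-∀

  high-block : ℤ₃ → Block
  high-block 0₃ = single 2₃
  high-block 1₃ = single 1₃
  high-block 2₃ = empty

  HighInv : ℕ → Set
  HighInv t = Reach (high-end t) (high-block (res₃ t))

  res₃-complement : ∀ t e → t + e ≡ 3 * k → res₃ e ≡ -₃ res₃ t
  res₃-complement t e te =
    +₃-inverseʳ-unique (res₃ t) (res₃ e) (trans (sym (res₃-+ t e)) (trans (cong res₃ te) (res₃-* 3 k)))

  high-step : ∀ t e → t + e ≡ 3 * k → HighInv t → HighInv (suc t)
  high-step t e te inv = by-residue (res₃ t) refl
    where
      t+[e+2]≡ : t + (e + 2) ≡ 3 * k + 2
      t+[e+2]≡ = trans (sym (+-assoc t e 2)) (cong (_+ 2) te)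
      t≤ : t ≤ 3 * k + 1
      t≤ = ≤-trans (≤-from-+ e te) (m≤m+n (3 * k) 1)
      window : ∀ ι {sa sb sc sd} → res₃ t ≡ ι →
        high-block ι ≡ run 1₃ (⟦ high-end-e ⟧₃ ι κ) sa →
        run 1₃ (⟦ dense₁-end-e ⟧₃ ι κ) (⟦ lit 2 :* jv :+ lit 3 ⟧₃ ι κ +₃ sa)
          ≡ run 2₃ (⟦ dense₁-end-e ⟧₃ ι κ) sb →
        run 2₃ (⟦ high-mid-e ⟧₃ ι κ) ((-₃ ι +₃ 2₃) +₃ sb) ≡ run 1₃ (⟦ high-mid-e ⟧₃ ι κ) sc →
        run 1₃ (⟦ dense₂-end-e ⟧₃ ι κ) (⟦ lit 2 :* jv :+ lit 1 ⟧₃ ι κ +₃ sc)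
          ≡ run 2₃ (⟦ dense₂-end-e ⟧₃ ι κ) sd →
        run 2₃ (⟦ high-end-e ⟧₃ (suc₃ ι) κ) (-₃ ι +₃ sd) ≡ high-block (suc₃ ι) →
        HighInv (suc t)
      window ι {sa} {sb} {sc} {sd} ht start turn₁ turn₂ turn₃ end =
        subst (Reach (high-end (suc t))) (trans block≡ (cong (λ σ → high-block (suc₃ σ)) (sym ht)))
          (high-window₂ t ι e ht te turn₃
            (subst (Reach (high-mid t)) mid≡
              (high-window₁ t ι (e + 2) ht t≤ t+[e+2]≡ (trans (cong high-block ht) start) turn₁
                inv)))
        where
          e≡ : res₃ e ≡ -₃ ι
          e≡ = trans (res₃-complement t e te) (cong -₃_ ht)
          mid≡ : run 2₃ (res₃ (high-mid t)) (res₃ (e + 2) +₃ sb) ≡ run 1₃ (res₃ (high-mid t)) sc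
          mid≡ = trans (cong₂ (λ ρ σ → run 2₃ ρ (σ +₃ sb)) (res₃-⟦⟧ high-mid-e t k ht)
                              (trans (res₃-+ e 2) (cong (_+₃ 2₃) e≡)))
                       (trans turn₂ (cong (λ ρ → run 1₃ ρ sc) (sym (res₃-⟦⟧ high-mid-e t k ht))))
          block≡ : run 2₃ (res₃ (high-end (suc t))) (res₃ e +₃ sd) ≡ high-block (suc₃ ι)
          block≡ = trans (cong₂ (λ ρ σ → run 2₃ ρ (σ +₃ sd)) (res₃-⟦⟧ high-end-e (suc t) k (cong suc₃ ht)) e≡)
                         end
      by-residue : ∀ ι → res₃ t ≡ ι → HighInv (suc t)
      by-residue 0₃ ht = window 0₃ {1₃} {1₃} {0₃} {1₃} ht refl refl refl refl refl
      by-residue 1₃ ht = window 1₃ {1₃} {0₃} {1₃} {1₃} ht refl refl refl refl refl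
      by-residue 2₃ ht = window 2₃ {0₃} {1₃} {1₃} {0₃} ht refl refl refl refl refl

  res₃[3k+1] : res₃ (3 * k + 1) ≡ 1₃
  res₃[3k+1] = trans (res₃-+ (3 * k) 1) (cong (_+₃ 1₃) (res₃-* 3 k))

  -- In the last low window 3k + 2 only 3k + 1 elements of B_i fit; the next one
  -- spills over into window 3k + 3.
  high-base : HighInv 0
  high-base = subst₂ Reach (cong low-end (1+[3k+1]≡3k+2+0 k))
    (cong (λ ρ → run 2₃ ρ (res₃ (3 * k + 1) +₃ 0₃)) (res₃-⟦⟧ end-e 0 k refl)
     ∙ cong (λ σ → run 2₃ 2₃ (σ +₃ 0₃)) res₃[3k+1])
    (low-window (3 * k + 1) 1₃ (3 * k + 1) 1 0 {empty} {1₃} {0₃} res₃[3k+1]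
      (≤-reflexive (sym (+-suc (3 * k) 1))) (n≤1+n _) ≤-refl (2[1+[3k+1]]+1≡6k+5 k) (6k+5+2[3k+1]+0≡12k+7 k) (λ _ ())
      tt refl refl
      (subst (λ σ → Reach (low-end (3 * k + 1)) (low-block (suc₃ σ))) res₃[3k+1] (low-all (3 * k + 1) ≤-refl)))
    where
      _∙_ = trans
      end-e : Expr
      end-e = (lit 1 :+ (lit 3 :* kv :+ lit 1)) :* a-e :+ (lit 6 :* kv :+ lit 5) :+ lit 2 :* (lit 3 :* kv :+ lit 1)
      1+[3k+1]≡3k+2+0 : ∀ k → suc (3 * k + 1) ≡ 3 * k + 2 + 0
      1+[3k+1]≡3k+2+0 = solve-∀
      2[1+[3k+1]]+1≡6k+5 : ∀ k → 2 * suc (3 * k + 1) + 1 ≡ 6 * k + 5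
      2[1+[3k+1]]+1≡6k+5 = solve-∀
      6k+5+2[3k+1]+0≡12k+7 : ∀ k → 6 * k + 5 + 2 * (3 * k + 1) + 0 ≡ 12 * k + 7
      6k+5+2[3k+1]+0≡12k+7 = solve-∀

  high-all : ∀ t → t ≤ 3 * k + 1 → HighInv t
  high-all zero    _  = high-base
  high-all (suc t) t< =
    let e , te = m≤n⇒∃[o]m+o≡n (s≤s⁻¹ (subst (suc t ≤_) (+-comm (3 * k) 1) t<))
    in  high-step t e te (high-all t (≤-trans (n≤1+n t) t<))

  -- After offset 6k + 6 of window 6k + 4 every integer lies in H₁₅.
  everywhere-good : ∀ x → Good x
  everywhere-good = all-good (high-mid (3 * k + 1)) 1₃
    (λ t → ∈-tail (≤-from-+ t (conductor+t≡1+[end+t] k t)))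
    (high-window₁ (3 * k + 1) 1₃ 1 res₃[3k+1] ≤-refl (+-assoc (3 * k) 1 1) (cong high-block res₃[3k+1]) refl
      (high-all (3 * k + 1) ≤-refl))
    where
      conductor+t≡1+[end+t] : ∀ k t → (6 * k + 4) * (12 * k + 8) + (6 * k + 4) + 3 + t
                      ≡ suc ((3 * k + 3 + (3 * k + 1)) * (12 * k + 8) + (6 * k + 6) + t)
      conductor+t≡1+[end+t] = solve-∀

-- H₁₅ as a 3-permutation semigroup

module Permutation (k : ℕ) where
  open Generators k
  open Membership k
  open Window k
  open Walk k

  H15-+ : ∀ x y → H15 k x → H15 k y → H15 k (x + y)
  H15-+ x y x∈ y∈ =
    to (generated⇔H15 (x + y))
       (generated-+ (aₖ k ∷ bₖ k ∷ cₖ k ∷ []) x y (from (generated⇔H15 x) x∈) (from (generated⇔H15 y) y∈))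
    where open Equivalence

  enum-1 : enum 1 ≡ aₖ k
  enum-1 = next-unique 0 (aₖ k) 0<a (subst (H15 k) a≡ (∈A 1 0 z≤n)) (λ w 0<w w<a → window₀-∉ w 0<w w<a)
    where
      a≡ : 1 * aₖ k + 2 * 0 ≡ aₖ k
      a≡ = trans (+-identityʳ (1 * aₖ k)) (*-identityˡ (aₖ k))

  enum-2 : enum 2 ≡ bₖ k
  enum-2 = trans (cong next enum-1) (next-unique (aₖ k) (bₖ k) (m<m+n (aₖ k) z<s) b∈ gap)
    where
      b∈ : H15 k (bₖ k)
      b∈ = subst (H15 k) (cong (_+ 2) (*-identityˡ (aₖ k))) (∈A 1 1 (s≤s z≤n))
      gap : ∀ w → aₖ k < w → w < bₖ k → ¬ H15 k w
      gap w a<w w<b w∈ =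
        odd-∉-middle 1 0
          (below-conductor 1 1 (≤-trans (s≤s z≤n) (m≤n+m 4 (6 * k))) (≤-trans (s≤s z≤n) (m≤n+m 6 (6 * k))))
          (≤-trans (s≤s z≤n) (m≤n+m 2 (3 * k))) z≤n (subst (H15 k) w≡ w∈)
        where
          w≡ : w ≡ 1 * aₖ k + (2 * 0 + 1)
          w≡ = trans (≤-antisym (s≤s⁻¹ (subst (suc w ≤_) (+-comm (aₖ k) 2) w<b)) a<w)
                     (sym (trans (cong (_+ 1) (*-identityˡ (aₖ k))) (+-comm (aₖ k) 1)))

  enum-3 : enum 3 ≡ cₖ k
  enum-3 = trans (cong next enum-2) (next-unique (bₖ k) (cₖ k) b<c c∈ gap)
    where
      c≡′ : ∀ k → 1 * (12 * k + 8) + (6 * k + 4) + 3 + 2 * 0 ≡ 18 * k + 15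
      c≡′ = solve-∀
      c∈ : H15 k (cₖ k)
      c∈ = subst (H15 k) (trans (c≡′ k) (sym c≡)) (∈B 0 0 z≤n)
      b<c : bₖ k < cₖ k
      b<c = subst (bₖ k <_) (sym c≡) (≤-from-+ (6 * k + 4) (1+b+[6k+4]≡c k))
        where
          1+b+[6k+4]≡c : ∀ k → suc (12 * k + 8 + 2) + (6 * k + 4) ≡ 18 * k + 15
          1+b+[6k+4]≡c = solve-∀
      gap : ∀ w → bₖ k < w → w < cₖ k → ¬ H15 k w
      gap w b<w w<c w∈ with m≤n⇒∃[o]m+o≡n b<w
      ... | d , refl = gap-after-A-∉ 1 (3 + d) (≤-trans (s≤s z≤n) (m≤n+m 2 (3 * k))) (s≤s (s≤s (s≤s z≤n))) y≤
                         (subst (H15 k) (w≡ k d) w∈)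
        where
          w≡ : ∀ k d → suc (12 * k + 8 + 2) + d ≡ 1 * (12 * k + 8) + (3 + d)
          w≡ = solve-∀
          1+[1+b+d]≡a+[1+[3+d]] : ∀ k d → suc (suc (12 * k + 8 + 2) + d) ≡ 12 * k + 8 + suc (3 + d)
          1+[1+b+d]≡a+[1+[3+d]] = solve-∀
          c≡a+[1+[6k+6]] : ∀ k → 18 * k + 15 ≡ 12 * k + 8 + suc (6 * k + 6)
          c≡a+[1+[6k+6]] = solve-∀
          y≤ : 3 + d ≤ 6 * k + 6
          y≤ = s≤s⁻¹ (+-cancelˡ-≤ (aₖ k) _ _ (subst₂ _≤_ (1+[1+b+d]≡a+[1+[3+d]] k d) (trans c≡ (c≡a+[1+[6k+6]] k)) w<c))

  generators : ∀ x → H15 k x ⇔ Generated (map (λ i → enum (suc i)) (upTo 3)) x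
  generators x = subst (λ gs → H15 k x ⇔ Generated gs x) (sym gens≡)
                       (mk⇔ (Equivalence.from (generated⇔H15 x)) (Equivalence.to (generated⇔H15 x)))
    where
      gens≡ : enum 1 ∷ enum 2 ∷ enum 3 ∷ [] ≡ aₖ k ∷ bₖ k ∷ cₖ k ∷ []
      gens≡ = cong₂ _∷_ enum-1 (cong₂ _∷_ enum-2 (cong₂ _∷_ enum-3 refl))

  H15-isPermutationNS : IsPermutationNS 3 (H15 k)
  H15-isPermutationNS = (inj₁ (0 , z≤n , inj₁ refl) , H15-+ , conductor , λ _ → ∈-tail)
                      , enum , enum-isEnumeration , generators , enum-residues everywhere-good

lemma4p15 : (k : ℕ) → 1 ≤ k →
    ((∀ x → Gₖ k x ⇔
        (∃[ q ] ∃[ r ] ∃[ v ] ∃[ ε ] (ε ≤ 1 × r ≤ q ×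
          x ≡ (q + 3 * v + ε) * aₖ k + ε * (aₖ k / 2) + 6 * v + 3 * ε + 2 * r)))
    × (∀ x → Gₖ k x ⇔ H15 k x)
    × IsPermutationNS 3 (H15 k))
lemma4p15 k _ = Generators.generated⇔param k , Membership.generated⇔H15 k , Permutation.H15-isPermutationNS k
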